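{- For every $n$ there is a bijection $f_{5,2}$ from $\mathcal{T}_{5,2}\cap\mathcal{A}_n$ onto the set of ascent sequences $s\in\mathcal{A}_n$ with $\mathrm{rpos}(s)\ne0$ such that (a) the rightmost occurrence of $\mathrm{Rmin}(s)_{\mathrm{rpos}(s)-1}$ is not immediately followed by the second rightmost occurrence of $\mathrm{Rmin}(s)_{\mathrm{rpos}(s)}$, and (b) the two rightmost occurrences of $\mathrm{Rmin}(s)_{\mathrm{rpos}(s)}$ are not adjacent. Moreover, for all $s\in\mathcal{T}_{5,2}\cap\mathcal{A}_n$: $\mathrm{asc},\mathrm{rep},\max,\mathrm{rmin}$ take the same values on $s$ and $f_{5,2}(s)$, $\mathrm{rpos}(s)=\mathrm{rpos}(f_{5,2}(s))-1$, $\mathrm{zero}(s)=\mathrm{zero}(f_{5,2}(s))+\chi(\mathrm{rpos}(s)=0)$ and $\mathrm{ealm}(s)=\mathrm{ealm}(f_{5,2}(s))-\chi(\mathrm{Prm}(s)_{\mathrm{rpos}(s)}=\max(s)+1)$.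
   Context: Inversion sequence: $s=(s_1,\dots,s_n)$, $0\le s_i<i$, $|s|=n$. $\mathrm{asc}(s)=|\{i:s_i<s_{i+1}\}|$. Ascent sequence: $s_i\le\mathrm{asc}(s_1,\dots,s_{i-1})+1$ for $i\ge2$; $\mathcal{A}_n$ = ascent sequences of length $n$; $\mathcal{A}^*$ = all ascent sequences except $(0,1,\dots,|s|-1)$. $\mathrm{rep}(s)=n-|\{s_i\}|$, $\mathrm{zero}(s)=|\{i:s_i=0\}|$, $\max(s)=|\{i:s_i=i-1\}|$, $\mathrm{ealm}(s)=s_{\max(s)+1}$ if $\max(s)\ne|s|$ and $0$ otherwise. $\mathrm{Rmin}(s)=\{s_i:s_i<s_j\ \forall j>i\}$, $\mathrm{rmin}(s)=|\mathrm{Rmin}(s)|$, $\mathrm{Rmin}(s)_j$ its $j$-th smallest element ($j\ge0$); $\mathrm{Prm}(s)$ = set of positions of right-to-left minima, $\mathrm{Prm}(s)_j$ its $j$-th smallest element ($j\ge0$). $\mathrm{rpos}(s)$ is the maximal $m$ such that $\mathrm{Rmin}(s)_m$ occurs at least twice after position $\mathrm{Prm}(s)_{m-1}$ (for $m=0$: at least twice in $s$); $0$ if none exists or $\mathrm{rmin}(s)=|s|$. $\mathrm{sebr}(s)$ = smallest entry strictly between the two rightmost occurrences of $\mathrm{Rmin}(s)_{\mathrm{rpos}(s)}$ ($0$ if adjacent). $\mathcal{A}^1=\{s\in\mathcal{A}^*:\mathrm{rpos}(s)<\mathrm{rmin}(s)-1,\ \mathrm{sebr}(s)\ge\mathrm{Rmin}(s)_{\mathrm{rpos}(s)+1}\}$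 and $\mathcal{T}_{5,2}=\{s\in\mathcal{A}^1:\mathrm{Prm}(s)_{\mathrm{rpos}(s)+1}\ne\mathrm{Prm}(s)_{\mathrm{rpos}(s)}+1\}$. $\chi(P)$ is $1$ if $P$ holds and $0$ otherwise. -}

module Defs where

open import Data.Nat using (ℕ; zero; suc; _+_; _∸_; _≤_; _<_; _⊔_; _⊓_; _≡ᵇ_; _<ᵇ_; _≟_)
open import Data.Bool using (Bool; true; false; if_then_else_; _∧_; not)
open import Data.List using (List; []; _∷_; length; map; upTo; filterᵇ; deduplicate; take; foldr; reverse)
open import Data.Product using (_×_)
open import Relation.Binary.PropositionalEquality using (_≡_; _≢_)
open import Relation.Nullary using (Dec; yes; no)

-- Sequences are lists of naturals; positions are 1-based as in the paper.

-- s_i (1-based); default 0 outside 1..|s|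
at : List ℕ → ℕ → ℕ
at []      _             = 0
at (x ∷ r) zero          = 0
at (x ∷ r) (suc zero)    = x
at (x ∷ r) (suc (suc i)) = at r (suc i)

-- j-th element (0-based) of a list; default 0
nth : List ℕ → ℕ → ℕ
nth []      _       = 0
nth (x ∷ r) zero    = x
nth (x ∷ r) (suc j) = nth r j

positions : List ℕ → List ℕ
positions s = map suc (upTo (length s))

countPos : List ℕ → (ℕ → Bool) → ℕ
countPos s p = length (filterᵇ p (positions s))

allB : (ℕ → Bool) → List ℕ → Bool
allB p []      = true
allB p (x ∷ r) = p x ∧ allB p r

χ : {P : Set} → Dec P → ℕ
χ (yes _) = 1
χ (no _)  = 0

asc : List ℕ → ℕ
asc (x ∷ y ∷ r) = (if x <ᵇ y then 1 else 0) + asc (y ∷ r)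
asc _           = 0

IsInversion : List ℕ → Set
IsInversion s = ∀ i → 1 ≤ i → i ≤ length s → at s i < i

IsAscent : List ℕ → Set
IsAscent s = IsInversion s ×
  (∀ i → 2 ≤ i → i ≤ length s → at s i ≤ suc (asc (take (i ∸ 1) s)))

InA : ℕ → List ℕ → Set
InA n s = IsAscent s × length s ≡ n

InAstar : List ℕ → Set
InAstar s = IsAscent s × s ≢ upTo (length s)

rep : List ℕ → ℕ
rep s = length s ∸ length (deduplicate _≟_ s)

zeroS : List ℕ → ℕ
zeroS s = countPos s (λ i → at s i ≡ᵇ 0)

maxS : List ℕ → ℕ
maxS s = countPos s (λ i → at s i ≡ᵇ (i ∸ 1))

ealm : List ℕ → ℕ
ealm s = if maxS s ≡ᵇ length s then 0 else at s (suc (maxS s))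

isRminPos : List ℕ → ℕ → Bool
isRminPos s i = allB (λ j → if i <ᵇ j then at s i <ᵇ at s j else true) (positions s)

-- Prm(s), listed in increasing order (Prm(s)_j = j-th element, 0-based)
prm : List ℕ → List ℕ
prm s = filterᵇ (isRminPos s) (positions s)

-- Rmin(s) listed in increasing order: right-to-left minima read left to right
-- (they strictly increase from left to right by definition)
rminList : List ℕ → List ℕ
rminList s = map (at s) (prm s)

rmin : List ℕ → ℕ
rmin s = length (prm s)

Prm : List ℕ → ℕ → ℕ
Prm s j = nth (prm s) j

Rmin : List ℕ → ℕ → ℕ
Rmin s j = nth (rminList s) j

occ : List ℕ → ℕ → List ℕ
occ s v = filterᵇ (λ i → at s i ≡ᵇ v) (positions s)

-- rightmost / second rightmost occurrence of v (0 if it does not exist)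
rocc1 : List ℕ → ℕ → ℕ
rocc1 s v = nth (reverse (occ s v)) 0

rocc2 : List ℕ → ℕ → ℕ
rocc2 s v = nth (reverse (occ s v)) 1

rposCond : List ℕ → ℕ → Bool
rposCond s zero    = 2 Data.Nat.≤ᵇ countPos s (λ i → at s i ≡ᵇ Rmin s 0)
rposCond s (suc m) = 2 Data.Nat.≤ᵇ countPos s (λ i → (Prm s m <ᵇ i) ∧ (at s i ≡ᵇ Rmin s (suc m)))

-- rpos(s): maximal m (over 0 ≤ m < rmin(s)) satisfying rposCond; 0 if none or rmin(s) = |s|
rpos : List ℕ → ℕ
rpos s = if rmin s ≡ᵇ length s then 0
         else foldr _⊔_ 0 (filterᵇ (rposCond s) (upTo (rmin s)))

-- minimum of a list (0 for the empty list)
minL : List ℕ → ℕ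
minL []      = 0
minL (x ∷ r) = foldr _⊓_ x r

-- sebr(s): smallest entry strictly between the two rightmost occurrences of
-- Rmin(s)_{rpos(s)}; 0 if they are adjacent (or if there are fewer than two occurrences)
sebr : List ℕ → ℕ
sebr s = if length (occ s v) Data.Nat.<ᵇ 2 then 0
         else minL (map (at s) (filterᵇ (λ i → (rocc2 s v <ᵇ i) ∧ (i <ᵇ rocc1 s v)) (positions s)))
  where v = Rmin s (rpos s)

InA1 : List ℕ → Set
InA1 s = InAstar s × suc (rpos s) < rmin s × Rmin s (suc (rpos s)) ≤ sebr s

InT52 : List ℕ → Set
InT52 s = InA1 s × Prm s (suc (rpos s)) ≢ suc (Prm s (rpos s))

InTarget : ℕ → List ℕ → Set
InTarget n s = InA n s × rpos s ≢ 0
  × suc (rocc1 s (Rmin s (rpos s ∸ 1))) ≢ rocc2 s (Rmin s (rpos s))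
  × suc (rocc2 s (Rmin s (rpos s))) ≢ rocc1 s (Rmin s (rpos s))

-- Write r = rpos(s), P = Prm(s)_r, Q = Prm(s)_{r+1}, a = Rmin(s)_r, b = Rmin(s)_{r+1}.
-- f₅₂ raises the entry a at P to b. For s ∈ T₅,₂ the condition sebr(s) ≥ b says that a
-- occurs again at some w < P, w + 1 < P, with all entries strictly between w and P at
-- least b, while the maximality of rpos says that after P the value b occurs only at Q.
-- Raising P therefore makes w the r-th right-to-left minimum in place of P and changes
-- nothing else about the right-to-left minima; now b occurs twice after w, so rpos grows
-- by one, and (a), (b) hold because w + 1 < P and P + 1 < Q (the T₅,₂ condition).
-- Conversely, lowering the second rightmost occurrence of b in a target sequence back to
-- a recreates exactly this configuration, so both directions are instances of one
-- situation. As a stays at w and b at Q, the set of values, the ascents and the fixed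
-- points are unchanged; a zero is lost iff a = 0 iff r = 0, and ealm grows iff P is the
-- first non-fixed position, where the fixed points force b = a + 1.

module Submission where

open import Defs
open import Data.Bool using (Bool; true; false; T; if_then_else_; _∧_)
open import Data.Bool.Properties using (T-∧; T-≡)
open import Data.Empty using (⊥; ⊥-elim)
open import Data.List using (List; []; _∷_; length; map; upTo; applyUpTo; filter; filterᵇ; foldr; take; reverse; deduplicate)
open import Data.List.Properties
  using (filter-notAll; length-take; length-reverse; foldr-preservesᵇ; foldr-preservesᵒ; unfold-reverse; take-all; take-[]; length-map; length-upTo)
open import Data.List.Membership.Propositional using (_∈_)
open import Data.List.Membership.Propositional.Properties
  using (∈-filter⁺; ∈-filter⁻; ∈-map⁺; ∈-map⁻; ∈-upTo⁺; ∈-upTo⁻; ∈-deduplicate⁺; ∈-deduplicate⁻)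
open import Data.List.Relation.Unary.All as All using (All; []; _∷_)
open import Data.List.Relation.Unary.Any as Any using (here; there)
open import Data.List.Relation.Unary.Any.Properties using (reverse⁺; reverse⁻)
open import Data.List.Relation.Unary.AllPairs as AllPairs using (AllPairs; []; _∷_)
import Data.List.Relation.Unary.AllPairs.Properties as AllPairsₚ
open import Data.List.Relation.Unary.Unique.Propositional using (Unique)
open import Data.Nat
open import Data.Nat.Properties
open import Data.List.Relation.Unary.Unique.DecPropositional.Properties _≟_ using (deduplicate-!)
open import Data.Product using (Σ; ∃; ∃-syntax; _×_; _,_; proj₁; proj₂)
open import Data.Sum using (_⊎_; inj₁; inj₂; [_,_])
open import Function using (_∘_; id; Equivalence)
open import Relation.Binary.PropositionalEquality hiding ([_])
open import Relation.Nullary using (¬_; Dec; yes; no; ¬?)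
open import Relation.Nullary.Decidable using (T?)
open import Relation.Binary.Definitions using (tri<; tri≈; tri>)
open import Induction.WellFounded using (Acc; acc)
open import Data.Nat.Induction using (<-wellFounded)

-- Lists

∸1-suc : ∀ {n} → 1 ≤ n → suc (n ∸ 1) ≡ n
∸1-suc {suc n} _ = refl

<ᵇ-true : ∀ {m n} → m < n → (m <ᵇ n) ≡ true
<ᵇ-true = Equivalence.to T-≡ ∘ <⇒<ᵇ

<ᵇ-false : ∀ {m n} → n ≤ m → (m <ᵇ n) ≡ false
<ᵇ-false {m} {n} n≤m with m <ᵇ n in lt
... | true  = ⊥-elim (<⇒≱ (<ᵇ⇒< m n (subst T (sym lt) _)) n≤m)
... | false = refl

≡ᵇ-false : ∀ {m n} → m ≢ n → (m ≡ᵇ n) ≡ false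
≡ᵇ-false {m} {n} m≢n with m ≡ᵇ n in eq
... | true  = ⊥-elim (m≢n (≡ᵇ⇒≡ m n (subst T (sym eq) _)))
... | false = refl

filterᵇ-cong : ∀ {p q : ℕ → Bool} xs → (∀ {x} → x ∈ xs → p x ≡ q x) → filterᵇ p xs ≡ filterᵇ q xs
filterᵇ-cong [] _ = refl
filterᵇ-cong {p} {q} (x ∷ xs) p≗q with p x | q x | p≗q (here refl)
... | true  | true  | _ = cong (x ∷_) (filterᵇ-cong xs (p≗q ∘ there))
... | false | false | _ = filterᵇ-cong xs (p≗q ∘ there)

length-filterᵇ-suc : ∀ (p q : ℕ → Bool) {xs y} → Unique xs → y ∈ xs → T (p y) → ¬ T (q y) →
  (∀ {x} → x ∈ xs → x ≢ y → p x ≡ q x) → length (filterᵇ p xs) ≡ suc (length (filterᵇ q xs))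
length-filterᵇ-suc p q {x ∷ xs} (x∉xs ∷ u) (here refl) py ¬qy p≗q with p x | q x
... | true  | false = cong (suc ∘ length) (filterᵇ-cong xs (λ m → p≗q (there m) (All.lookup x∉xs m ∘ sym)))
... | true  | true  = ⊥-elim (¬qy _)
length-filterᵇ-suc p q {x ∷ xs} (x∉xs ∷ u) (there y∈) py ¬qy p≗q
  with p x | q x | p≗q (here refl) (λ x≡y → All.lookup x∉xs y∈ x≡y)
... | true  | true  | _ = cong suc (length-filterᵇ-suc p q u y∈ py ¬qy (p≗q ∘ there))
... | false | false | _ = length-filterᵇ-suc p q u y∈ py ¬qy (p≗q ∘ there)

⊔-foldr-upper : ∀ {x xs} → x ∈ xs → x ≤ foldr _⊔_ 0 xs
⊔-foldr-upper {x} x∈ = foldr-preservesᵒ {P = x ≤_}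
  (λ m n → [ (λ x≤m → ≤-trans x≤m (m≤m⊔n m n)) , (λ x≤n → ≤-trans x≤n (m≤n⊔m m n)) ])
  0 _ (inj₂ (Any.map (λ { refl → ≤-refl }) x∈))

⊔-foldr-least : ∀ {xs m} → All (_≤ m) xs → foldr _⊔_ 0 xs ≤ m
⊔-foldr-least = foldr-preservesᵇ ⊔-lub z≤n

⊔-foldr-∈ : ∀ xs → foldr _⊔_ 0 xs ∈ xs ⊎ foldr _⊔_ 0 xs ≡ 0
⊔-foldr-∈ xs = foldr-preservesᵇ {P = InOrZero} pick (inj₂ refl) (All.tabulate inj₁)
  where
  InOrZero : ℕ → Set
  InOrZero z = z ∈ xs ⊎ z ≡ 0
  pick : ∀ {m n} → InOrZero m → InOrZero n → InOrZero (m ⊔ n)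
  pick {m} {n} pm pn with ⊔-sel m n
  ... | inj₁ e = subst InOrZero (sym e) pm
  ... | inj₂ e = subst InOrZero (sym e) pn

Unique-length-≤ : ∀ {xs ys : List ℕ} → Unique xs → (∀ {z} → z ∈ xs → z ∈ ys) → length xs ≤ length ys
Unique-length-≤ {[]} _ _ = z≤n
Unique-length-≤ {x ∷ xs} {ys} (x∉xs ∷ u) xs⊆ys = begin-strict
  length xs                          ≤⟨ Unique-length-≤ u xs⊆ys-x ⟩
  length (filter (¬? ∘ (x ≟_)) ys)   <⟨ filter-notAll (¬? ∘ (x ≟_)) ys (Any.map (λ x≡z x≢z → x≢z x≡z) (xs⊆ys (here refl))) ⟩
  length ys                          ∎
  where
  open ≤-Reasoning
  xs⊆ys-x : ∀ {z} → z ∈ xs → z ∈ filter (¬? ∘ (x ≟_)) ys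
  xs⊆ys-x z∈ = ∈-filter⁺ (¬? ∘ (x ≟_)) (xs⊆ys (there z∈)) (All.lookup x∉xs z∈)

deduplicate-length-cong : ∀ {xs ys : List ℕ} → (∀ {z} → z ∈ xs → z ∈ ys) → (∀ {z} → z ∈ ys → z ∈ xs) →
  length (deduplicate _≟_ xs) ≡ length (deduplicate _≟_ ys)
deduplicate-length-cong {xs} {ys} xs⊆ys ys⊆xs = ≤-antisym
  (Unique-length-≤ (deduplicate-! xs) (∈-deduplicate⁺ _≟_ ∘ xs⊆ys ∘ ∈-deduplicate⁻ _≟_ xs))
  (Unique-length-≤ (deduplicate-! ys) (∈-deduplicate⁺ _≟_ ∘ ys⊆xs ∘ ∈-deduplicate⁻ _≟_ ys))

nth-∈ : ∀ xs {j} → j < length xs → nth xs j ∈ xs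
nth-∈ (x ∷ xs) {zero}  _   = here refl
nth-∈ (x ∷ xs) {suc j} j<n = there (nth-∈ xs (s≤s⁻¹ j<n))

∈⇒nth : ∀ {xs z} → z ∈ xs → ∃[ j ] j < length xs × nth xs j ≡ z
∈⇒nth (here refl) = 0 , z<s , refl
∈⇒nth (there z∈)  = let j , j<n , e = ∈⇒nth z∈ in suc j , s≤s j<n , e

nth-≥length : ∀ xs {j} → length xs ≤ j → nth xs j ≡ 0
nth-≥length []       _               = refl
nth-≥length (x ∷ xs) {suc j} (s≤s n≤j) = nth-≥length xs n≤j

nth-map : ∀ (f : ℕ → ℕ) → f 0 ≡ 0 → ∀ xs j → nth (map f xs) j ≡ f (nth xs j)
nth-map f f0 []       j       = sym f0
nth-map f f0 (x ∷ xs) zero    = refl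
nth-map f f0 (x ∷ xs) (suc j) = nth-map f f0 xs j

nth-ext : ∀ {xs ys} → length xs ≡ length ys → (∀ j → j < length xs → nth xs j ≡ nth ys j) → xs ≡ ys
nth-ext {[]}     {[]}     _   _  = refl
nth-ext {x ∷ xs} {y ∷ ys} len eq =
  cong₂ _∷_ (eq 0 z<s) (nth-ext (suc-injective len) (λ j j<n → eq (suc j) (s≤s j<n)))

setAt : List ℕ → ℕ → ℕ → List ℕ
setAt []       _       v = []
setAt (x ∷ xs) zero    v = v ∷ xs
setAt (x ∷ xs) (suc j) v = x ∷ setAt xs j v

length-setAt : ∀ xs j v → length (setAt xs j v) ≡ length xs
length-setAt []       _       v = refl
length-setAt (x ∷ xs) zero    v = refl
length-setAt (x ∷ xs) (suc j) v = cong suc (length-setAt xs j v)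

nth-setAt-≡ : ∀ xs {j} v → j < length xs → nth (setAt xs j v) j ≡ v
nth-setAt-≡ (x ∷ xs) {zero}  v _   = refl
nth-setAt-≡ (x ∷ xs) {suc j} v j<n = nth-setAt-≡ xs v (s≤s⁻¹ j<n)

nth-setAt-≢ : ∀ xs {j k} v → k ≢ j → nth (setAt xs j v) k ≡ nth xs k
nth-setAt-≢ []       v _ = refl
nth-setAt-≢ (x ∷ xs) {zero}  {zero}  v k≢j = ⊥-elim (k≢j refl)
nth-setAt-≢ (x ∷ xs) {zero}  {suc k} v _   = refl
nth-setAt-≢ (x ∷ xs) {suc j} {zero}  v _   = refl
nth-setAt-≢ (x ∷ xs) {suc j} {suc k} v k≢j = nth-setAt-≢ xs v (k≢j ∘ cong suc)

nth-mono-< : ∀ {xs} → AllPairs _<_ xs → ∀ {j k} → j < k → k < length xs → nth xs j < nth xs k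
nth-mono-< (x<xs ∷ _)  {zero}  {suc k} _   k<n = All.lookup x<xs (nth-∈ _ (s≤s⁻¹ k<n))
nth-mono-< (_ ∷ sorted) {suc j} {suc k} j<k k<n = nth-mono-< sorted (s≤s⁻¹ j<k) (s≤s⁻¹ k<n)

nth-mono-≤ : ∀ {xs} → AllPairs _<_ xs → ∀ {j k} → j ≤ k → k < length xs → nth xs j ≤ nth xs k
nth-mono-≤ sorted j≤k k<n with m≤n⇒m<n∨m≡n j≤k
... | inj₁ j<k  = <⇒≤ (nth-mono-< sorted j<k k<n)
... | inj₂ refl = ≤-refl

nth-cancel-< : ∀ {xs} → AllPairs _<_ xs → ∀ {j k} → j < length xs → nth xs j < nth xs k → j < k
nth-cancel-< sorted {j} {k} j<n lt = ≰⇒> λ k≤j → <⇒≱ lt (nth-mono-≤ sorted k≤j j<n)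

nth-injective : ∀ {xs} → AllPairs _<_ xs → ∀ {j k} → j < length xs → k < length xs → nth xs j ≡ nth xs k → j ≡ k
nth-injective sorted {j} {k} j<n k<n e with <-cmp j k
... | tri< j<k _ _ = ⊥-elim (<-irrefl e (nth-mono-< sorted j<k k<n))
... | tri≈ _ j≡k _ = j≡k
... | tri> _ _ k<j = ⊥-elim (<-irrefl (sym e) (nth-mono-< sorted k<j j<n))

sorted-unique : ∀ {xs ys} → AllPairs _<_ xs → AllPairs _<_ ys →
  (∀ {z} → z ∈ xs → z ∈ ys) → (∀ {z} → z ∈ ys → z ∈ xs) → xs ≡ ys
sorted-unique {[]}     {[]}     _ _ _ _ = refl
sorted-unique {[]}     {y ∷ ys} _ _ _ ys⊆xs with () ← ys⊆xs (here refl)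
sorted-unique {x ∷ xs} {[]}     _ _ xs⊆ys _ with () ← xs⊆ys (here refl)
sorted-unique {x ∷ xs} {y ∷ ys} (x<xs ∷ sx) (y<ys ∷ sy) xs⊆ys ys⊆xs =
  cong₂ _∷_ x≡y (sorted-unique sx sy (tail xs⊆ys x<xs y<ys x≡y) (tail ys⊆xs y<ys x<xs (sym x≡y)))
  where
  head-≤ : ∀ {u v vs} → All (v <_) vs → u ∈ v ∷ vs → v ≤ u
  head-≤ _    (here refl) = ≤-refl
  head-≤ v<vs (there u∈)  = <⇒≤ (All.lookup v<vs u∈)
  x≡y : x ≡ y
  x≡y = ≤-antisym (head-≤ {vs = xs} x<xs (ys⊆xs (here refl))) (head-≤ {vs = ys} y<ys (xs⊆ys (here refl)))
  tail : ∀ {u v us vs} → (∀ {z} → z ∈ u ∷ us → z ∈ v ∷ vs) → All (u <_) us → All (v <_) vs → u ≡ v →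
    ∀ {z} → z ∈ us → z ∈ vs
  tail us⊆vs u<us _ u≡v z∈ with us⊆vs (there z∈)
  ... | here refl = ⊥-elim (<-irrefl u≡v (All.lookup u<us z∈))
  ... | there z∈vs = z∈vs

∈-setAt⁻ : ∀ {xs r w z} → AllPairs _<_ xs → r < length xs → z ∈ setAt xs r w → z ≡ w ⊎ (z ∈ xs × z ≢ nth xs r)
∈-setAt⁻ {xs} {r} {w} sorted r<n z∈ with ∈⇒nth z∈
... | k , k<n′ , refl with k ≟ r
...   | yes refl = inj₁ (nth-setAt-≡ xs w r<n)
...   | no k≢r   = inj₂ (subst (_∈ xs) (sym (nth-setAt-≢ xs w k≢r)) (nth-∈ xs k<n)
                        , λ e → k≢r (nth-injective sorted k<n r<n (trans (sym (nth-setAt-≢ xs w k≢r)) e)))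
  where k<n = subst (k <_) (length-setAt xs r w) k<n′

∈-setAt⁺ : ∀ {xs r w z} → z ∈ xs → z ≢ nth xs r → z ∈ setAt xs r w
∈-setAt⁺ {xs} {r} {w} z∈ z≢ with ∈⇒nth z∈
... | k , k<n , refl = subst (_∈ setAt xs r w) (nth-setAt-≢ xs w (λ { refl → z≢ refl }))
                         (nth-∈ (setAt xs r w) (subst (k <_) (sym (length-setAt xs r w)) k<n))

∈-setAt-self : ∀ {xs r} w → r < length xs → w ∈ setAt xs r w
∈-setAt-self {xs} {r} w r<n =
  subst (_∈ setAt xs r w) (nth-setAt-≡ xs w r<n) (nth-∈ (setAt xs r w) (subst (r <_) (sym (length-setAt xs r w)) r<n))

setAt-sorted : ∀ {xs r y} → AllPairs _<_ xs → r < length xs → (∀ {j} → j < r → nth xs j < y) →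
  (∀ {k} → r < k → k < length xs → y < nth xs k) → AllPairs _<_ (setAt xs r y)
setAt-sorted {x ∷ xs} {zero} {y} (_ ∷ sorted) _ _ y<after = All.tabulate y<rest ∷ sorted
  where
  y<rest : ∀ {z} → z ∈ xs → y < z
  y<rest z∈ = let k , k<n , e = ∈⇒nth z∈ in subst (_ <_) e (y<after {suc k} z<s (s≤s k<n))
setAt-sorted {x ∷ xs} {suc r} {y} (x<xs ∷ sorted) r<n before after =
  All.tabulate x<new ∷ setAt-sorted sorted (s≤s⁻¹ r<n) (before ∘ s≤s) (λ r<k k<n → after (s≤s r<k) (s≤s k<n))
  where
  x<new : ∀ {z} → z ∈ setAt xs r y → x < z
  x<new z∈ with ∈-setAt⁻ sorted (s≤s⁻¹ r<n) z∈
  ... | inj₁ refl      = before {0} z<s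
  ... | inj₂ (z∈xs , _) = All.lookup x<xs z∈xs

sorted-setAt : ∀ {xs ys r w} → AllPairs _<_ xs → AllPairs _<_ ys → r < length xs → w < nth xs r →
  (∀ {z} → z ∈ xs → w ≤ z → z < nth xs r → ⊥) →
  w ∈ ys → (∀ {z} → z ∈ xs → z ≢ nth xs r → z ∈ ys) → (∀ {z} → z ∈ ys → z ≢ w → z ∈ xs × z ≢ nth xs r) →
  ys ≡ setAt xs r w
sorted-setAt {xs} {ys} {r} {w} sx sy r<n w<x gap w∈ys xs⊆ys ys⊆xs =
  sorted-unique sy (setAt-sorted sx r<n before after) ys⊆new new⊆ys
  where
  before : ∀ {j} → j < r → nth xs j < w
  before j<r = ≰⇒> λ w≤ → gap (nth-∈ xs (<-trans j<r r<n)) w≤ (nth-mono-< sx j<r r<n)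
  after : ∀ {k} → r < k → k < length xs → w < nth xs k
  after r<k k<n = <-trans w<x (nth-mono-< sx r<k k<n)
  ys⊆new : ∀ {z} → z ∈ ys → z ∈ setAt xs r w
  ys⊆new {z} z∈ with z ≟ w
  ... | yes refl = ∈-setAt-self w r<n
  ... | no z≢w   = let z∈xs , z≢x = ys⊆xs z∈ z≢w in ∈-setAt⁺ z∈xs z≢x
  new⊆ys : ∀ {z} → z ∈ setAt xs r w → z ∈ ys
  new⊆ys z∈ with ∈-setAt⁻ sx r<n z∈
  ... | inj₁ refl          = w∈ys
  ... | inj₂ (z∈xs , z≢x) = xs⊆ys z∈xs z≢x

reverse-decreasing : ∀ {xs} → AllPairs _<_ xs → AllPairs _>_ (reverse xs)
reverse-decreasing {[]}     []               = []
reverse-decreasing {x ∷ xs} (x<xs ∷ sorted) rewrite unfold-reverse x xs =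
  AllPairsₚ.++⁺ (reverse-decreasing sorted) ([] ∷ []) (All.tabulate (λ z∈ → All.lookup x<xs (reverse⁻ z∈) ∷ []))

nth-0-max : ∀ {xs y} → AllPairs _>_ xs → y ∈ xs → (∀ {z} → z ∈ xs → z ≤ y) → nth xs 0 ≡ y
nth-0-max _           (here refl) _  = refl
nth-0-max (x>xs ∷ _) (there y∈)  ≤y = ⊥-elim (<⇒≱ (All.lookup x>xs y∈) (≤y (here refl)))

nth-1-max : ∀ {xs x y} → AllPairs _>_ xs → x ∈ xs → y ∈ xs → x < y → (∀ {z} → z ∈ xs → z ≤ y) →
  (∀ {z} → z ∈ xs → z < y → z ≤ x) → nth xs 1 ≡ x
nth-1-max dec@(h>t ∷ dt) x∈ y∈ x<y ≤y ≤x with nth-0-max dec y∈ ≤y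
... | refl with x∈
...   | here refl = ⊥-elim (<-irrefl refl x<y)
...   | there x∈t = nth-0-max dt x∈t (λ z∈t → ≤x (there z∈t) (All.lookup h>t z∈t))

nth-0-∈ : ∀ {xs} → 1 ≤ length xs → nth xs 0 ∈ xs
nth-0-∈ {x ∷ xs} _ = here refl

nth-1-spec : ∀ {xs} → AllPairs _>_ xs → 2 ≤ length xs →
  nth xs 1 ∈ xs × nth xs 1 < nth xs 0 × (∀ {z} → z ∈ xs → z < nth xs 0 → z ≤ nth xs 1)
nth-1-spec {_ ∷ []} _ (s≤s ())
nth-1-spec {h ∷ x ∷ t} ((h>x ∷ _) ∷ (x>t ∷ _)) _ = there (here refl) , h>x , below
  where
  below : ∀ {z} → z ∈ h ∷ x ∷ t → z < h → z ≤ x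
  below (here refl)          z<h = ⊥-elim (<-irrefl refl z<h)
  below (there (here refl))  _   = ≤-refl
  below (there (there z∈t))  _   = <⇒≤ (All.lookup x>t z∈t)

∈⇒length≥1 : ∀ {xs : List ℕ} {x} → x ∈ xs → 1 ≤ length xs
∈⇒length≥1 (here _)  = s≤s z≤n
∈⇒length≥1 (there _) = s≤s z≤n

∈⇒length≥2 : ∀ {xs : List ℕ} {x y} → x ∈ xs → y ∈ xs → x ≢ y → 2 ≤ length xs
∈⇒length≥2 (here refl) (here refl) x≢y = ⊥-elim (x≢y refl)
∈⇒length≥2 (here refl) (there y∈)  _   = s≤s (∈⇒length≥1 y∈)
∈⇒length≥2 (there x∈)  _           _   = s≤s (∈⇒length≥1 x∈)

-- Positions, ascents and fixed points

at-0 : ∀ xs → at xs 0 ≡ 0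
at-0 []       = refl
at-0 (x ∷ xs) = refl

at-suc : ∀ xs i → at xs (suc i) ≡ nth xs i
at-suc []       i       = refl
at-suc (x ∷ xs) zero    = refl
at-suc (x ∷ xs) (suc i) = at-suc xs i

at-∈ : ∀ xs {i} → 1 ≤ i → i ≤ length xs → at xs i ∈ xs
at-∈ xs {suc i} _ i<n = subst (_∈ xs) (sym (at-suc xs i)) (nth-∈ xs i<n)

∈⇒at : ∀ {xs z} → z ∈ xs → ∃[ i ] 1 ≤ i × i ≤ length xs × at xs i ≡ z
∈⇒at {xs} z∈ = let j , j<n , e = ∈⇒nth z∈ in suc j , s≤s z≤n , j<n , trans (at-suc xs j) e

at-ext : ∀ {xs ys} → length xs ≡ length ys → (∀ i → 1 ≤ i → i ≤ length xs → at xs i ≡ at ys i) → xs ≡ ys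
at-ext {xs} {ys} len eq =
  nth-ext len λ j j<n → trans (sym (at-suc xs j)) (trans (eq (suc j) (s≤s z≤n) j<n) (at-suc ys j))

at-setAt-≡ : ∀ xs {p} v → 1 ≤ p → p ≤ length xs → at (setAt xs (p ∸ 1) v) p ≡ v
at-setAt-≡ xs {suc p} v _ p<n = trans (at-suc (setAt xs p v) p) (nth-setAt-≡ xs v p<n)

at-setAt-≢ : ∀ xs {p i} v → 1 ≤ p → i ≢ p → at (setAt xs (p ∸ 1) v) i ≡ at xs i
at-setAt-≢ xs {suc p} {zero}  v _ _   = trans (at-0 (setAt xs p v)) (sym (at-0 xs))
at-setAt-≢ xs {suc p} {suc i} v _ i≢p =
  trans (at-suc (setAt xs p v) i) (trans (nth-setAt-≢ xs v (i≢p ∘ cong suc)) (sym (at-suc xs i)))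

setAt-restore : ∀ {xs ys p} → length xs ≡ length ys → 1 ≤ p → p ≤ length ys →
  (∀ i → i ≢ p → at xs i ≡ at ys i) → setAt xs (p ∸ 1) (at ys p) ≡ ys
setAt-restore {xs} {ys} {p} len 1≤p p≤n agree = at-ext (trans (length-setAt xs _ _) len) (λ i _ _ → pointwise i)
  where
  pointwise : ∀ i → at (setAt xs (p ∸ 1) (at ys p)) i ≡ at ys i
  pointwise i with i ≟ p
  ... | yes refl = at-setAt-≡ xs _ 1≤p (subst (p ≤_) (sym len) p≤n)
  ... | no i≢p   = trans (at-setAt-≢ xs _ 1≤p i≢p) (agree i i≢p)

positions-cong : ∀ {xs ys : List ℕ} → length xs ≡ length ys → positions xs ≡ positions ys
positions-cong = cong (map suc ∘ upTo)

∈-map-suc-upTo : ∀ {n i} → 1 ≤ i → i ≤ n → i ∈ map suc (upTo n)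
∈-map-suc-upTo {i = suc i} _ i<n = ∈-map⁺ suc (∈-upTo⁺ i<n)

∈-positions⁺ : ∀ s {i} → 1 ≤ i → i ≤ length s → i ∈ positions s
∈-positions⁺ s = ∈-map-suc-upTo

∈-positions⁻ : ∀ s {i} → i ∈ positions s → 1 ≤ i × i ≤ length s
∈-positions⁻ s i∈ with ∈-map⁻ suc i∈
... | j , j∈ , refl = s≤s z≤n , ∈-upTo⁻ j∈

positions-sorted : ∀ s → AllPairs _<_ (positions s)
positions-sorted s = AllPairsₚ.map⁺ (AllPairsₚ.applyUpTo⁺₁ id (length s) (λ i<j _ → s≤s i<j))

module _ (s : List ℕ) (p : ℕ → Bool) where

  ∈-filterPos⁺ : ∀ {i} → 1 ≤ i → i ≤ length s → T (p i) → i ∈ filterᵇ p (positions s)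
  ∈-filterPos⁺ 1≤i i≤n pi = ∈-filter⁺ (T? ∘ p) (∈-positions⁺ s 1≤i i≤n) pi

  ∈-filterPos⁻ : ∀ {i} → i ∈ filterᵇ p (positions s) → 1 ≤ i × i ≤ length s × T (p i)
  ∈-filterPos⁻ i∈ = let i∈s , pi = ∈-filter⁻ (T? ∘ p) i∈ ; 1≤i , i≤n = ∈-positions⁻ s i∈s in 1≤i , i≤n , pi

  filterPos-sorted : AllPairs _<_ (filterᵇ p (positions s))
  filterPos-sorted = AllPairsₚ.filter⁺ (T? ∘ p) (positions-sorted s)

  countPos≥2 : ∀ {i j} → 1 ≤ i → i < j → j ≤ length s → T (p i) → T (p j) → 2 ≤ countPos s p
  countPos≥2 1≤i i<j j≤n pi pj = ∈⇒length≥2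
    (∈-filterPos⁺ 1≤i (<⇒≤ (<-≤-trans i<j j≤n)) pi) (∈-filterPos⁺ (≤-trans 1≤i (<⇒≤ i<j)) j≤n pj) (<⇒≢ i<j)

  countPos≥2⁻ : 2 ≤ countPos s p → ∃[ i ] ∃[ j ] i < j × j ≤ length s × T (p i) × T (p j)
  countPos≥2⁻ 2≤count with filterᵇ p (positions s) | filterPos-sorted | ∈-filterPos⁻ | 2≤count
  ... | []        | _             | _    | ()
  ... | _ ∷ []    | _             | _    | s≤s ()
  ... | i ∷ j ∷ _ | (i<j ∷ _) ∷ _ | spec | _ =
    i , j , i<j , proj₁ (proj₂ (spec (there (here refl)))) , proj₂ (proj₂ (spec (here refl))) , proj₂ (proj₂ (spec (there (here refl))))

  countPos≤1 : ∀ q → (∀ i → 1 ≤ i → i ≤ length s → T (p i) → i ≡ q) → countPos s p ≤ 1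
  countPos≤1 q only-q with filterᵇ p (positions s) | filterPos-sorted | ∈-filterPos⁻
  ... | []        | _             | _    = z≤n
  ... | _ ∷ []    | _             | _    = s≤s z≤n
  ... | i ∷ j ∷ _ | (i<j ∷ _) ∷ _ | spec = ⊥-elim (<-irrefl (trans (≡q (here refl)) (sym (≡q (there (here refl))))) i<j)
    where ≡q : ∀ {k} → k ∈ i ∷ j ∷ _ → k ≡ q
          ≡q k∈ = let 1≤k , k≤n , pk = spec k∈ in only-q _ 1≤k k≤n pk

countPos-cong : ∀ s {p q : ℕ → Bool} → (∀ i → 1 ≤ i → i ≤ length s → p i ≡ q i) → countPos s p ≡ countPos s q
countPos-cong s eq = cong length (filterᵇ-cong (positions s) λ i∈ → let 1≤i , i≤n = ∈-positions⁻ s i∈ in eq _ 1≤i i≤n)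

countPos-length : ∀ {s t} (p : ℕ → Bool) → length s ≡ length t → countPos s p ≡ countPos t p
countPos-length {s} {t} p len = cong (length ∘ filterᵇ p) (positions-cong {s} {t} len)

length-positions : ∀ s → length (positions s) ≡ length s
length-positions s = trans (length-map suc (upTo (length s))) (length-upTo (length s))

nth-applyUpTo : ∀ f n {j} → j < n → nth (applyUpTo f n) j ≡ f j
nth-applyUpTo f (suc n) {zero}  _   = refl
nth-applyUpTo f (suc n) {suc j} j<n = nth-applyUpTo (f ∘ suc) n (s≤s⁻¹ j<n)

at-upTo : ∀ n {i} → 1 ≤ i → i ≤ n → at (upTo n) i ≡ i ∸ 1
at-upTo n {suc i} _ i<n = trans (at-suc (upTo n) i) (nth-applyUpTo id n i<n)

repeated⇒≢upTo : ∀ {xs i j} → 1 ≤ i → i < j → j ≤ length xs → at xs i ≡ at xs j → xs ≢ upTo (length xs)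
repeated⇒≢upTo {xs} {suc i} {suc j} _ i<j j≤n repeat xs≡upTo = <-irrefl (cong suc i≡j) i<j
  where
  identity : ∀ {k} → 1 ≤ k → k ≤ length xs → at xs k ≡ k ∸ 1
  identity 1≤k k≤n = trans (cong (λ ys → at ys _) xs≡upTo) (at-upTo (length xs) 1≤k k≤n)
  i≡j : i ≡ j
  i≡j = trans (sym (identity (s≤s z≤n) (<⇒≤ (<-≤-trans i<j j≤n)))) (trans repeat (identity (s≤s z≤n) j≤n))

asc-take-cong : ∀ xs ys → length xs ≡ length ys →
  (∀ i → 1 ≤ i → suc i ≤ length xs → (at xs i <ᵇ at xs (suc i)) ≡ (at ys i <ᵇ at ys (suc i))) →
  ∀ m → asc (take m xs) ≡ asc (take m ys)
asc-take-cong _ _ _ _ zero = refl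
asc-take-cong []           []           _   _     (suc m)       = refl
asc-take-cong (x ∷ [])      (y ∷ [])      _   _     (suc zero)    = refl
asc-take-cong (x ∷ [])      (y ∷ [])      _   _     (suc (suc m)) = refl
asc-take-cong (x ∷ x′ ∷ xs) (y ∷ y′ ∷ ys) _   _     (suc zero)    = refl
asc-take-cong (x ∷ x′ ∷ xs) (y ∷ y′ ∷ ys) len pairs (suc (suc m)) =
  cong₂ _+_ (cong (λ b → if b then 1 else 0) (pairs 1 ≤-refl (s≤s (s≤s z≤n))))
    (asc-take-cong (x′ ∷ xs) (y′ ∷ ys) (suc-injective len) shifted (suc m))
  where
  shifted : ∀ i → 1 ≤ i → suc i ≤ length (x′ ∷ xs) →
    (at (x′ ∷ xs) i <ᵇ at (x′ ∷ xs) (suc i)) ≡ (at (y′ ∷ ys) i <ᵇ at (y′ ∷ ys) (suc i))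
  shifted (suc i) _ i<n = pairs (suc (suc i)) (s≤s z≤n) (s≤s i<n)
asc-take-cong []           (_ ∷ _)      () _ (suc m)
asc-take-cong (_ ∷ _)      []           () _ (suc m)
asc-take-cong (_ ∷ [])     (_ ∷ _ ∷ _)  () _ (suc m)
asc-take-cong (_ ∷ _ ∷ _)  (_ ∷ [])     () _ (suc m)

asc-cong : ∀ xs ys → length xs ≡ length ys →
  (∀ i → 1 ≤ i → suc i ≤ length xs → (at xs i <ᵇ at xs (suc i)) ≡ (at ys i <ᵇ at ys (suc i))) → asc xs ≡ asc ys
asc-cong xs ys len pairs = subst₂ (λ u v → asc u ≡ asc v)
  (take-all (length xs) xs ≤-refl) (take-all (length xs) ys (≤-reflexive (sym len))) (asc-take-cong xs ys len pairs (length xs))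

at-take : ∀ xs k {i} → i ≤ k → at (take k xs) i ≡ at xs i
at-take []       k       {i}           _   = cong (λ ys → at ys i) (take-[] k)
at-take (x ∷ xs) zero    {zero}        _   = refl
at-take (x ∷ xs) (suc k) {zero}        _   = refl
at-take (x ∷ xs) (suc k) {suc zero}    _   = refl
at-take (x ∷ xs) (suc k) {suc (suc i)} i≤k = at-take xs k (s≤s⁻¹ i≤k)

asc-take-mono : ∀ xs k → asc (take k xs) ≤ asc (take (suc k) xs)
asc-take-mono []            k       = ≤-reflexive (cong asc (trans (take-[] k) (sym (take-[] (suc k)))))
asc-take-mono (x ∷ [])      zero    = z≤n
asc-take-mono (x ∷ [])      (suc k) = ≤-reflexive (cong (λ ys → asc (x ∷ ys)) (trans (take-[] k) (sym (take-[] (suc k)))))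
asc-take-mono (x ∷ y ∷ xs) zero          = z≤n
asc-take-mono (x ∷ y ∷ xs) (suc zero)    = z≤n
asc-take-mono (x ∷ y ∷ xs) (suc (suc k)) = +-monoʳ-≤ (if x <ᵇ y then 1 else 0) (asc-take-mono (y ∷ xs) (suc k))

asc≤length∸1 : ∀ xs → asc xs ≤ length xs ∸ 1
asc≤length∸1 []           = z≤n
asc≤length∸1 (x ∷ [])     = z≤n
asc≤length∸1 (x ∷ y ∷ xs) = step (x <ᵇ y) (asc≤length∸1 (y ∷ xs))
  where
  step : ∀ b {m n} → m ≤ n → (if b then 1 else 0) + m ≤ suc n
  step true  = s≤s
  step false = m≤n⇒m≤1+n

asc-maximal⇒increasing : ∀ xs → length xs ∸ 1 ≤ asc xs → ∀ i → 1 ≤ i → suc i ≤ length xs → at xs i < at xs (suc i)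
asc-maximal⇒increasing (x ∷ y ∷ xs) full i 1≤i i<n with x <ᵇ y in x<ᵇy
asc-maximal⇒increasing (x ∷ y ∷ xs) full (suc zero) _ _ | true = <ᵇ⇒< x y (subst T (sym x<ᵇy) _)
asc-maximal⇒increasing (x ∷ y ∷ xs) full (suc (suc i)) _ (s≤s i<n) | true =
  asc-maximal⇒increasing (y ∷ xs) (s≤s⁻¹ full) (suc i) (s≤s z≤n) i<n
... | false = ⊥-elim (<-irrefl refl (≤-trans full (asc≤length∸1 (y ∷ xs))))
asc-maximal⇒increasing (x ∷ []) _ (suc i) _ (s≤s ())

IsAscent-transfer : ∀ {xs ys} → IsAscent xs → length ys ≡ length xs → (∀ m → asc (take m ys) ≡ asc (take m xs)) →
  (∀ i → 1 ≤ i → i ≤ length xs → at ys i ≤ at xs i ⊎ (2 ≤ i × at ys i ≤ at xs (i ∸ 1))) → IsAscent ys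
IsAscent-transfer {xs} {ys} (inv , bounded) len prefix dominated = inv′ , bounded′
  where
  in-xs : ∀ {i} → i ≤ length ys → i ≤ length xs
  in-xs {i} = subst (i ≤_) len
  inv′ : IsInversion ys
  inv′ i 1≤i i≤n with dominated i 1≤i (in-xs i≤n)
  inv′ i             1≤i i≤n | inj₁ le = ≤-<-trans le (inv i 1≤i (in-xs i≤n))
  inv′ (suc zero)    _   _   | inj₂ (s≤s () , _)
  inv′ (suc (suc k)) _   i≤n | inj₂ (_ , le) =
    <-trans (≤-<-trans le (inv (suc k) (s≤s z≤n) (≤-trans (n≤1+n _) (in-xs i≤n)))) (n<1+n _)
  bounded′ : ∀ i → 2 ≤ i → i ≤ length ys → at ys i ≤ suc (asc (take (i ∸ 1) ys))
  bounded′ i 2≤i i≤n rewrite prefix (i ∸ 1) with dominated i (≤-trans (s≤s z≤n) 2≤i) (in-xs i≤n)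
  bounded′ i             2≤i i≤n | inj₁ le = ≤-trans le (bounded i 2≤i (in-xs i≤n))
  bounded′ (suc zero) (s≤s ()) _ | _
  bounded′ (suc (suc zero)) _ i≤n | inj₂ (_ , le) =
    ≤-trans le (≤-trans (s≤s⁻¹ (inv 1 ≤-refl (≤-trans (n≤1+n _) (in-xs i≤n)))) z≤n)
  bounded′ (suc (suc (suc k))) _ i≤n | inj₂ (_ , le) =
    ≤-trans le (≤-trans (bounded (suc (suc k)) (s≤s (s≤s z≤n)) (≤-trans (n≤1+n _) (in-xs i≤n)))
                        (s≤s (asc-take-mono xs (suc k))))

fixed⇒increasing : ∀ {s} → IsAscent s → ∀ {k} → suc (suc k) ≤ length s → at s (suc (suc k)) ≡ suc k →
  ∀ {l} → 1 ≤ l → l ≤ k → at s l < at s (suc l)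
fixed⇒increasing {s} (_ , bounded) {k} k+2≤n fixed {l} 1≤l l≤k =
  subst₂ _<_ (at-take s (suc k) (≤-trans l≤k (n≤1+n k))) (at-take s (suc k) (s≤s l≤k))
    (asc-maximal⇒increasing prefix full l 1≤l (subst (suc l ≤_) (sym length-prefix) (s≤s l≤k)))
  where
  prefix = take (suc k) s
  length-prefix : length prefix ≡ suc k
  length-prefix = trans (length-take (suc k) s) (m≤n⇒m⊓n≡m (≤-trans (n≤1+n _) k+2≤n))
  full : length prefix ∸ 1 ≤ asc prefix
  full = subst (λ m → m ∸ 1 ≤ asc prefix) (sym length-prefix)
    (s≤s⁻¹ (subst (_≤ suc (asc prefix)) fixed (bounded (suc (suc k)) (s≤s (s≤s z≤n)) k+2≤n)))

fixed-prefix : ∀ {s} → IsAscent s → ∀ {i} → i ≤ length s → at s i ≡ i ∸ 1 → ∀ {j} → 1 ≤ j → j ≤ i → at s j ≡ j ∸ 1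
fixed-prefix {s} asc-s {i} i≤n fixed {j} 1≤j j≤i with m≤n⇒m<n∨m≡n j≤i
... | inj₂ refl = fixed
... | inj₁ j<i  = below i≤n fixed 1≤j j<i
  where
  below : ∀ {i j} → i ≤ length s → at s i ≡ i ∸ 1 → 1 ≤ j → j < i → at s j ≡ j ∸ 1
  below {suc zero}    {suc j} _   _     _ (s≤s ())
  below {suc (suc k)} {suc j} i≤n fixed _ j<i =
    ≤-antisym (s≤s⁻¹ (proj₁ asc-s (suc j) (s≤s z≤n) (≤-trans (<⇒≤ j<i) i≤n))) (lower (suc j) (s≤s z≤n) (s≤s⁻¹ j<i))
    where
    lower : ∀ l → 1 ≤ l → l ≤ suc k → l ∸ 1 ≤ at s l
    lower (suc zero)     _ _   = z≤n
    lower (suc (suc l)) _ l≤k = ≤-trans (s≤s (lower (suc l) (s≤s z≤n) (≤-trans (n≤1+n _) l≤k)))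
                                        (fixed⇒increasing asc-s i≤n fixed (s≤s z≤n) (s≤s⁻¹ l≤k))

maxS-prefix : ∀ {s} → IsAscent s → ∀ {i} → 1 ≤ i → i ≤ maxS s → at s i ≡ i ∸ 1
maxS-prefix {s} asc-s {suc i} 1≤i i≤M with at s (suc i) ≟ i
... | yes fixed  = fixed
... | no ¬fixed = ⊥-elim (<-irrefl refl (<-≤-trans (s≤s M≤i) i≤M))
  where
  isFixed = λ z → at s z ≡ᵇ (z ∸ 1)
  before-i : ∀ {z} → z ∈ filterᵇ isFixed (positions s) → z ∈ map suc (upTo i)
  before-i z∈ = let 1≤z , z≤len , fz = ∈-filterPos⁻ s isFixed z∈ in
    ∈-map-suc-upTo 1≤z (s≤s⁻¹ (≰⇒> (λ i<z → ¬fixed (fixed-prefix asc-s z≤len (≡ᵇ⇒≡ _ _ fz) 1≤i i<z))))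
  M≤i : maxS s ≤ i
  M≤i = ≤-trans (Unique-length-≤ (AllPairs.map <⇒≢ (filterPos-sorted s isFixed)) before-i)
                (≤-reflexive (trans (length-map suc (upTo i)) (length-upTo i)))

χ-cong : ∀ {P Q : Set} (p : Dec P) (q : Dec Q) → (P → Q) → (Q → P) → χ p ≡ χ q
χ-cong (yes _)  (yes _)  _ _ = refl
χ-cong (yes p) (no ¬q)  f _ = ⊥-elim (¬q (f p))
χ-cong (no ¬p) (yes q)  _ g = ⊥-elim (¬p (g q))
χ-cong (no _)  (no _)   _ _ = refl

χ-no : ∀ {P : Set} (p : Dec P) → ¬ P → χ p ≡ 0
χ-no (yes p) ¬p = ⊥-elim (¬p p)
χ-no (no _)  _  = refl

ealm-full : ∀ s → maxS s ≡ length s → ealm s ≡ 0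
ealm-full s M≡n with maxS s ≡ᵇ length s in eq
... | true  = refl
... | false = ⊥-elim (subst T eq (≡⇒≡ᵇ _ _ M≡n))

ealm-partial : ∀ s → maxS s ≢ length s → ealm s ≡ at s (suc (maxS s))
ealm-partial s M≢n with maxS s ≡ᵇ length s in eq
... | true  = ⊥-elim (M≢n (≡ᵇ⇒≡ _ _ (subst T (sym eq) _)))
... | false = refl

-- Right-to-left minima

IsRmin : List ℕ → ℕ → Set
IsRmin s i = ∀ j → i < j → j ≤ length s → at s i < at s j

T-allB⁻ : ∀ (p : ℕ → Bool) xs → T (allB p xs) → ∀ {x} → x ∈ xs → T (p x)
T-allB⁻ p (y ∷ xs) all {x} x∈ with p y in py | x∈
... | true | here refl = subst T (sym py) _
... | true | there x∈xs = T-allB⁻ p xs all x∈xs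

T-allB⁺ : ∀ (p : ℕ → Bool) xs → (∀ {x} → x ∈ xs → T (p x)) → T (allB p xs)
T-allB⁺ p []       _   = _
T-allB⁺ p (y ∷ xs) all with p y in py
... | true  = T-allB⁺ p xs (all ∘ there)
... | false = subst T py (all (here refl))

allB-false⁻ : ∀ (p : ℕ → Bool) xs → allB p xs ≡ false → ∃[ x ] x ∈ xs × p x ≡ false
allB-false⁻ p (y ∷ xs) all with p y in py
... | true  = let x , x∈ , px = allB-false⁻ p xs all in x , there x∈ , px
... | false = y , here refl , py

isRminPos⇒IsRmin : ∀ s {i} → T (isRminPos s i) → IsRmin s i
isRminPos⇒IsRmin s {i} rmin? j i<j j≤n with T-allB⁻ _ (positions s) rmin? (∈-positions⁺ s (≤-trans (s≤s z≤n) i<j) j≤n)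
... | later rewrite Equivalence.to T-≡ (<⇒<ᵇ i<j) = <ᵇ⇒< _ _ later

IsRmin⇒isRminPos : ∀ s {i} → IsRmin s i → T (isRminPos s i)
IsRmin⇒isRminPos s {i} rmin = T-allB⁺ _ (positions s) later
  where
  later : ∀ {j} → j ∈ positions s → T (if i <ᵇ j then at s i <ᵇ at s j else true)
  later {j} j∈ with i <ᵇ j in i<ᵇj
  ... | true  = <⇒<ᵇ (rmin j (<ᵇ⇒< i j (subst T (sym i<ᵇj) _)) (proj₂ (∈-positions⁻ s j∈)))
  ... | false = _

∈-prm⁺ : ∀ s {i} → 1 ≤ i → i ≤ length s → IsRmin s i → i ∈ prm s
∈-prm⁺ s 1≤i i≤n rmin = ∈-filterPos⁺ s (isRminPos s) 1≤i i≤n (IsRmin⇒isRminPos s rmin)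

∈-prm⁻ : ∀ s {i} → i ∈ prm s → 1 ≤ i × i ≤ length s × IsRmin s i
∈-prm⁻ s i∈ = let 1≤i , i≤n , rmin? = ∈-filterPos⁻ s (isRminPos s) i∈ in 1≤i , i≤n , isRminPos⇒IsRmin s rmin?

prm-sorted : ∀ s → AllPairs _<_ (prm s)
prm-sorted s = filterPos-sorted s (isRminPos s)

Prm-∈ : ∀ s {j} → j < rmin s → Prm s j ∈ prm s
Prm-∈ s = nth-∈ (prm s)

Prm-spec : ∀ s {j} → j < rmin s → 1 ≤ Prm s j × Prm s j ≤ length s × IsRmin s (Prm s j)
Prm-spec s = ∈-prm⁻ s ∘ Prm-∈ s

Rmin≡at : ∀ s j → Rmin s j ≡ at s (Prm s j)
Rmin≡at s = nth-map (at s) (at-0 s) (prm s)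

Prm-mono : ∀ s {j k} → j < k → k < rmin s → Prm s j < Prm s k
Prm-mono s = nth-mono-< (prm-sorted s)

Rmin-mono : ∀ s {j k} → j < k → k < rmin s → Rmin s j < Rmin s k
Rmin-mono s {j} {k} j<k k<r rewrite Rmin≡at s j | Rmin≡at s k =
  proj₂ (proj₂ (Prm-spec s (<-trans j<k k<r))) (Prm s k) (Prm-mono s j<k k<r) (proj₁ (proj₂ (Prm-spec s k<r)))

Prm-injective : ∀ s {j k} → j < rmin s → k < rmin s → Prm s j ≡ Prm s k → j ≡ k
Prm-injective s = nth-injective (prm-sorted s)

Prm-next : ∀ s {j z} → j < rmin s → z ∈ prm s → Prm s j < z → suc j < rmin s × Prm s (suc j) ≤ z
Prm-next s {j} j<r z∈ Pj<z =
  let k , k<r , e = ∈⇒nth z∈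
      j<k = nth-cancel-< (prm-sorted s) j<r (subst (Prm s j <_) (sym e) Pj<z)
  in <-≤-trans (s≤s j<k) k<r , subst (Prm s (suc j) ≤_) e (nth-mono-≤ (prm-sorted s) j<k k<r)


rmin≡length⇒IsRmin : ∀ s {i} → rmin s ≡ length s → 1 ≤ i → i ≤ length s → IsRmin s i
rmin≡length⇒IsRmin s {i} r≡n 1≤i i≤n with isRminPos s i in rmin?
... | true  = isRminPos⇒IsRmin s (subst T (sym rmin?) _)
... | false = ⊥-elim (<-irrefl (trans r≡n (sym (length-positions s)))
  (filter-notAll (T? ∘ isRminPos s) (positions s) (Any.map (λ { refl → subst T rmin? }) (∈-positions⁺ s 1≤i i≤n))))

prm-below : ∀ s {i} → 1 ≤ i → i ≤ length s → ∃[ k ] k ∈ prm s × i ≤ k × at s k ≤ at s i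
prm-below s {i} = go i (<-wellFounded (length s ∸ i))
  where
  go : ∀ i → Acc _<_ (length s ∸ i) → 1 ≤ i → i ≤ length s → ∃[ k ] k ∈ prm s × i ≤ k × at s k ≤ at s i
  go i (acc rec) 1≤i i≤n with isRminPos s i in rmin?
  ... | true  = i , ∈-filterPos⁺ s (isRminPos s) 1≤i i≤n (subst T (sym rmin?) _) , ≤-refl , ≤-refl
  ... | false with allB-false⁻ _ (positions s) rmin?
  ...   | j , j∈ , later with i <ᵇ j in i<ᵇj
  ...     | false = ⊥-elim (subst T later _)
  ...     | true  =
    let i<j = <ᵇ⇒< i j (subst T (sym i<ᵇj) _)
        _ , j≤n = ∈-positions⁻ s j∈
        k , k∈ , j≤k , sk≤sj = go j (rec (∸-monoʳ-< i<j j≤n)) (≤-trans 1≤i (<⇒≤ i<j)) j≤n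
    in k , k∈ , ≤-trans (<⇒≤ i<j) j≤k , ≤-trans sk≤sj (≮⇒≥ (λ sj<si → subst T later (<⇒<ᵇ sj<si)))

IsRmin-≤ : ∀ s {i k} → IsRmin s i → i ≤ k → k ≤ length s → at s i ≤ at s k
IsRmin-≤ s rmin i≤k k≤n with m≤n⇒m<n∨m≡n i≤k
... | inj₁ i<k  = <⇒≤ (rmin _ i<k k≤n)
... | inj₂ refl = ≤-refl

IsRmin-suffix : ∀ {s t i} → length s ≡ length t → (∀ j → i ≤ j → at s j ≡ at t j) → IsRmin s i → IsRmin t i
IsRmin-suffix {s} {t} {i} len agree rmin j i<j j≤n =
  subst₂ _<_ (agree i ≤-refl) (agree j (<⇒≤ i<j)) (rmin j i<j (subst (j ≤_) (sym len) j≤n))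

Rmin-suc-≤ : ∀ s {j i} → suc j < rmin s → Prm s j < i → i ≤ length s → Rmin s (suc j) ≤ at s i
Rmin-suc-≤ s {j} {i} j+1<r Pj<i i≤n =
  let k , k∈ , i≤k , sk≤si = prm-below s (≤-trans (s≤s z≤n) Pj<i) i≤n
      _ , Pj+1≤k = Prm-next s (<-trans (n<1+n j) j+1<r) k∈ (<-≤-trans Pj<i i≤k)
      _ , k≤n , _ = ∈-prm⁻ s k∈
  in subst (_≤ at s i) (sym (Rmin≡at s (suc j)))
       (≤-trans (IsRmin-≤ s (proj₂ (proj₂ (Prm-spec s j+1<r))) Pj+1≤k k≤n) sk≤si)

Rmin-0 : ∀ s → IsInversion s → 1 ≤ length s → Rmin s 0 ≡ 0
Rmin-0 s inv 1≤n = n≤0⇒n≡0 (begin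
  Rmin s 0         ≡⟨ Rmin≡at s 0 ⟩
  at s (Prm s 0)   ≤⟨ IsRmin-≤ s (proj₂ (proj₂ (Prm-spec s 0<r))) P₀≤k k≤n ⟩
  at s k           ≤⟨ sk≤s₁ ⟩
  at s 1           ≤⟨ s≤s⁻¹ (inv 1 ≤-refl 1≤n) ⟩
  0                ∎)
  where
  open ≤-Reasoning
  below = prm-below s ≤-refl 1≤n
  k = proj₁ below
  k∈ = proj₁ (proj₂ below)
  sk≤s₁ = proj₂ (proj₂ (proj₂ below))
  k≤n = proj₁ (proj₂ (∈-prm⁻ s k∈))
  0<r = ∈⇒length≥1 k∈
  P₀≤k : Prm s 0 ≤ k
  P₀≤k = let idx , idx<r , e = ∈⇒nth k∈ in subst (Prm s 0 ≤_) e (nth-mono-≤ (prm-sorted s) z≤n idx<r)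

-- Occurrences, sebr and rpos

∈-occ⁺ : ∀ s {v i} → 1 ≤ i → i ≤ length s → at s i ≡ v → i ∈ occ s v
∈-occ⁺ s {v} 1≤i i≤n si≡v = ∈-filterPos⁺ s (λ i → at s i ≡ᵇ v) 1≤i i≤n (≡⇒≡ᵇ _ _ si≡v)

∈-occ⁻ : ∀ s {v i} → i ∈ occ s v → 1 ≤ i × i ≤ length s × at s i ≡ v
∈-occ⁻ s {v} i∈ = let 1≤i , i≤n , si≡v = ∈-filterPos⁻ s (λ i → at s i ≡ᵇ v) i∈ in 1≤i , i≤n , ≡ᵇ⇒≡ _ _ si≡v

occ-decreasing : ∀ s v → AllPairs _>_ (reverse (occ s v))
occ-decreasing s v = reverse-decreasing (filterPos-sorted s _)

rocc1≡ : ∀ s {v y} → 1 ≤ y → y ≤ length s → at s y ≡ v → (∀ z → y < z → z ≤ length s → at s z ≢ v) → rocc1 s v ≡ y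
rocc1≡ s {v} 1≤y y≤n sy≡v no-later = nth-0-max (occ-decreasing s v) (reverse⁺ (∈-occ⁺ s 1≤y y≤n sy≡v)) λ z∈ →
  let _ , z≤len , sz≡v = ∈-occ⁻ s (reverse⁻ z∈) in ≮⇒≥ λ y<z → no-later _ y<z z≤len sz≡v

rocc≡ : ∀ s {v x y} → 1 ≤ x → x < y → y ≤ length s → at s x ≡ v → at s y ≡ v →
  (∀ z → y < z → z ≤ length s → at s z ≢ v) → (∀ z → x < z → z < y → at s z ≢ v) → rocc1 s v ≡ y × rocc2 s v ≡ x
rocc≡ s {v} {x} {y} 1≤x x<y y≤n sx≡v sy≡v no-later no-between =
  rocc1≡ s (≤-trans 1≤x (<⇒≤ x<y)) y≤n sy≡v no-later ,
  nth-1-max (occ-decreasing s v) (occurs 1≤x (<⇒≤ (<-≤-trans x<y y≤n)) sx≡v) (occurs (≤-trans 1≤x (<⇒≤ x<y)) y≤n sy≡v) x<y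
    (λ z∈ → let _ , z≤len , sz≡v = ∈-occ⁻ s (reverse⁻ z∈) in ≮⇒≥ λ y<z → no-later _ y<z z≤len sz≡v)
    (λ z∈ z<y → let _ , _ , sz≡v = ∈-occ⁻ s (reverse⁻ z∈) in ≮⇒≥ λ x<z → no-between _ x<z z<y sz≡v)
  where
  occurs : ∀ {i} → 1 ≤ i → i ≤ length s → at s i ≡ v → i ∈ reverse (occ s v)
  occurs 1≤i i≤n si≡v = reverse⁺ (∈-occ⁺ s 1≤i i≤n si≡v)

rocc1≤length : ∀ s v → 1 ≤ length (occ s v) → rocc1 s v ≤ length s
rocc1≤length s v 1≤occ =
  proj₁ (proj₂ (∈-occ⁻ s (reverse⁻ (nth-0-∈ (subst (1 ≤_) (sym (length-reverse (occ s v))) 1≤occ)))))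

rocc2-spec : ∀ s v → 2 ≤ length (occ s v) →
  1 ≤ rocc2 s v × rocc2 s v < rocc1 s v × at s (rocc2 s v) ≡ v ×
  (∀ z → 1 ≤ z → z ≤ length s → at s z ≡ v → z < rocc1 s v → z ≤ rocc2 s v)
rocc2-spec s v 2≤occ =
  let x∈ , x<y , below = nth-1-spec (occ-decreasing s v) (subst (2 ≤_) (sym (length-reverse (occ s v))) 2≤occ)
      1≤x , _ , sx≡v = ∈-occ⁻ s (reverse⁻ x∈)
  in 1≤x , x<y , sx≡v , λ z 1≤z z≤len sz≡v z<y → below (reverse⁺ (∈-occ⁺ s 1≤z z≤len sz≡v)) z<y

minL-≥ : ∀ {xs b} → 1 ≤ length xs → All (b ≤_) xs → b ≤ minL xs
minL-≥ {x ∷ xs} _ (b≤x ∷ b≤xs) = foldr-preservesᵇ ⊓-glb b≤x b≤xs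

minL-≤ : ∀ {xs y} → y ∈ xs → minL xs ≤ y
minL-≤ {x ∷ xs} {y} y∈ = foldr-preservesᵒ {P = _≤ y}
  (λ m n → [ (λ m≤y → ≤-trans (m⊓n≤m m n) m≤y) , (λ n≤y → ≤-trans (m⊓n≤n m n) n≤y) ]) x xs (head-or-tail y∈)
  where
  head-or-tail : y ∈ x ∷ xs → x ≤ y ⊎ Any.Any (_≤ y) xs
  head-or-tail (here refl) = inj₁ ≤-refl
  head-or-tail (there y∈xs) = inj₂ (Any.map (λ { refl → ≤-refl }) y∈xs)

module _ (s : List ℕ) where
  private
    v = Rmin s (rpos s)
    InGap = λ i → (rocc2 s v <ᵇ i) ∧ (i <ᵇ rocc1 s v)
    gap = filterᵇ InGap (positions s)

  sebr-unfold : 2 ≤ length (occ s v) → sebr s ≡ minL (map (at s) gap)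
  sebr-unfold 2≤occ with length (occ s v) <ᵇ 2 in few
  ... | true  = ⊥-elim (<⇒≱ (<ᵇ⇒< _ _ (subst T (sym few) _)) 2≤occ)
  ... | false = refl

  sebr-few : length (occ s v) < 2 → sebr s ≡ 0
  sebr-few occ<2 with length (occ s v) <ᵇ 2 in few
  ... | true  = refl
  ... | false = ⊥-elim (subst T few (<⇒<ᵇ occ<2))

  ∈-gap⁺ : ∀ {i} → rocc2 s v < i → i < rocc1 s v → i ≤ length s → i ∈ gap
  ∈-gap⁺ r₂<i i<r₁ i≤n = ∈-filterPos⁺ s InGap (≤-trans (s≤s z≤n) r₂<i) i≤n (Equivalence.from T-∧ (<⇒<ᵇ r₂<i , <⇒<ᵇ i<r₁))

  ∈-gap⁻ : ∀ {i} → i ∈ gap → rocc2 s v < i × i < rocc1 s v × i ≤ length s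
  ∈-gap⁻ i∈ = let _ , i≤n , inGap = ∈-filterPos⁻ s InGap i∈ ; r₂<i , i<r₁ = Equivalence.to T-∧ inGap in
    <ᵇ⇒< _ _ r₂<i , <ᵇ⇒< _ _ i<r₁ , i≤n

  ≤sebr⇒ : ∀ {b} → 1 ≤ b → b ≤ sebr s →
    2 ≤ length (occ s v) × suc (rocc2 s v) < rocc1 s v × (∀ i → rocc2 s v < i → i < rocc1 s v → i ≤ length s → b ≤ at s i)
  ≤sebr⇒ {b} 1≤b b≤sebr with length (occ s v) <? 2
  ... | yes occ<2 = ⊥-elim (<⇒≱ 1≤b (subst (b ≤_) (sebr-few occ<2) b≤sebr))
  ... | no ¬occ<2 = 2≤occ , gap-exists ,
    λ i r₂<i i<r₁ i≤n → ≤-trans b≤min (minL-≤ (∈-map⁺ (at s) (∈-gap⁺ r₂<i i<r₁ i≤n)))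
    where
    2≤occ = ≮⇒≥ ¬occ<2
    b≤min = subst (b ≤_) (sebr-unfold 2≤occ) b≤sebr
    element : ∀ xs → 1 ≤ minL (map (at s) xs) → ∃[ i ] i ∈ xs
    element (i ∷ _) _ = i , here refl
    gap-exists : suc (rocc2 s v) < rocc1 s v
    gap-exists = let i , i∈ = element gap (≤-trans 1≤b b≤min) ; r₂<i , i<r₁ , _ = ∈-gap⁻ i∈ in ≤-<-trans r₂<i i<r₁

  ≤sebr : ∀ {b} → 2 ≤ length (occ s v) → suc (rocc2 s v) < rocc1 s v →
    (∀ i → rocc2 s v < i → i < rocc1 s v → i ≤ length s → b ≤ at s i) → b ≤ sebr s
  ≤sebr {b} 2≤occ r₂+1<r₁ b≤gap = subst (b ≤_) (sym (sebr-unfold 2≤occ)) (minL-≥ nonempty (All.tabulate b≤))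
    where
    r₂+1∈ : suc (rocc2 s v) ∈ gap
    r₂+1∈ = ∈-gap⁺ ≤-refl r₂+1<r₁ (<⇒≤ (<-≤-trans r₂+1<r₁ (rocc1≤length s v (≤-trans (s≤s z≤n) 2≤occ))))
    nonempty : 1 ≤ length (map (at s) gap)
    nonempty = ∈⇒length≥1 (∈-map⁺ (at s) r₂+1∈)
    b≤ : ∀ {x} → x ∈ map (at s) gap → b ≤ x
    b≤ x∈ with ∈-map⁻ (at s) x∈
    ... | i , i∈ , refl = let r₂<i , i<r₁ , i≤n = ∈-gap⁻ i∈ in b≤gap i r₂<i i<r₁ i≤n

module _ (s : List ℕ) (m : ℕ) where
  private
    LaterEq = λ i → (Prm s m <ᵇ i) ∧ (at s i ≡ᵇ Rmin s (suc m))

    later : ∀ {i} → Prm s m < i → at s i ≡ Rmin s (suc m) → T (LaterEq i)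
    later Pm<i si≡ = Equivalence.from T-∧ (<⇒<ᵇ Pm<i , ≡⇒≡ᵇ _ _ si≡)

    later⁻ : ∀ {i} → T (LaterEq i) → Prm s m < i × at s i ≡ Rmin s (suc m)
    later⁻ l = let Pm<i , si≡ = Equivalence.to T-∧ l in <ᵇ⇒< _ _ Pm<i , ≡ᵇ⇒≡ _ _ si≡

  rposCond-suc⁺ : ∀ {x y} → Prm s m < x → x < y → y ≤ length s →
    at s x ≡ Rmin s (suc m) → at s y ≡ Rmin s (suc m) → T (rposCond s (suc m))
  rposCond-suc⁺ Pm<x x<y y≤n sx≡ sy≡ =
    ≤⇒≤ᵇ (countPos≥2 s LaterEq (≤-trans (s≤s z≤n) Pm<x) x<y y≤n (later Pm<x sx≡) (later (<-trans Pm<x x<y) sy≡))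

  rposCond-suc⁻ : T (rposCond s (suc m)) → ∃[ x ] ∃[ y ]
    Prm s m < x × x < y × y ≤ length s × at s x ≡ Rmin s (suc m) × at s y ≡ Rmin s (suc m)
  rposCond-suc⁻ cond =
    let x , y , x<y , y≤n , lx , ly = countPos≥2⁻ s LaterEq (≤ᵇ⇒≤ 2 _ cond)
        Pm<x , sx≡ = later⁻ lx
    in x , y , Pm<x , x<y , y≤n , sx≡ , proj₂ (later⁻ ly)

  rposCond-suc-unique : ∀ q → (∀ z → Prm s m < z → z ≤ length s → at s z ≡ Rmin s (suc m) → z ≡ q) →
    ¬ T (rposCond s (suc m))
  rposCond-suc-unique q only-q cond = <⇒≱ (≤ᵇ⇒≤ 2 _ cond)
    (countPos≤1 s LaterEq q (λ z _ z≤len lz → let Pm<z , sz≡ = later⁻ lz in only-q z Pm<z z≤len sz≡))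

rposCond-suc-cong : ∀ {s t} m → length s ≡ length t → Prm s m ≡ Prm t m → Rmin s (suc m) ≡ Rmin t (suc m) →
  (∀ i → Prm s m < i → i ≤ length s → at s i ≡ at t i) → rposCond s (suc m) ≡ rposCond t (suc m)
rposCond-suc-cong {s} {t} m len P≡ R≡ agree =
  cong (2 ≤ᵇ_) (trans (countPos-cong s pointwise) (countPos-length {s} {t} _ len))
  where
  pointwise : ∀ i → 1 ≤ i → i ≤ length s →
    ((Prm s m <ᵇ i) ∧ (at s i ≡ᵇ Rmin s (suc m))) ≡ ((Prm t m <ᵇ i) ∧ (at t i ≡ᵇ Rmin t (suc m)))
  pointwise i _ i≤n rewrite R≡ with Prm s m <ᵇ i in lt
  ... | true  rewrite sym P≡ | lt | agree i (<ᵇ⇒< _ _ (subst T (sym lt) _)) i≤n = refl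
  ... | false rewrite sym P≡ | lt = refl

RposMaximal : List ℕ → ℕ → Set
RposMaximal s r = r < rmin s × T (rposCond s r) × (∀ m → r < m → m < rmin s → ¬ T (rposCond s m))

module _ (s : List ℕ) where
  private
    candidates = filterᵇ (rposCond s) (upTo (rmin s))

    ∈-candidates⁺ : ∀ {m} → m < rmin s → T (rposCond s m) → m ∈ candidates
    ∈-candidates⁺ m<k cond = ∈-filter⁺ (T? ∘ rposCond s) (∈-upTo⁺ m<k) cond

    ∈-candidates⁻ : ∀ {m} → m ∈ candidates → m < rmin s × T (rposCond s m)
    ∈-candidates⁻ m∈ = let m∈upTo , cond = ∈-filter⁻ (T? ∘ rposCond s) m∈ in ∈-upTo⁻ m∈upTo , cond

    rpos-unfold : rmin s ≢ length s → rpos s ≡ foldr _⊔_ 0 candidates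
    rpos-unfold k≢n with rmin s ≡ᵇ length s in eq
    ... | true  = ⊥-elim (k≢n (≡ᵇ⇒≡ _ _ (subst T (sym eq) _)))
    ... | false = refl

    rpos-full : rmin s ≡ length s → rpos s ≡ 0
    rpos-full k≡n with rmin s ≡ᵇ length s in eq
    ... | true  = refl
    ... | false = ⊥-elim (subst T eq (≡⇒≡ᵇ _ _ k≡n))

    rpos-candidate : rmin s ≢ length s → rpos s ∈ candidates → RposMaximal s (rpos s)
    rpos-candidate k≢n rpos∈ = let r<k , cond = ∈-candidates⁻ rpos∈ in
      r<k , cond , λ m r<m m<k cm → <⇒≱ r<m (subst (m ≤_) (sym (rpos-unfold k≢n)) (⊔-foldr-upper (∈-candidates⁺ m<k cm)))

  rpos≡ : rmin s ≢ length s → ∀ {r} → RposMaximal s r → rpos s ≡ r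
  rpos≡ k≢n (r<k , cond , maximal) = trans (rpos-unfold k≢n) (≤-antisym
    (⊔-foldr-least (All.tabulate λ m∈ → let m<k , cm = ∈-candidates⁻ m∈ in ≮⇒≥ λ r<m → maximal _ r<m m<k cm))
    (⊔-foldr-upper (∈-candidates⁺ r<k cond)))

  rpos-maximal : rmin s ≢ length s → ∀ {m} → m < rmin s → T (rposCond s m) → RposMaximal s (rpos s)
  rpos-maximal k≢n {m} m<k cm = rpos-candidate k≢n (subst (_∈ candidates) (sym (rpos-unfold k≢n)) max∈)
    where
    m∈ = ∈-candidates⁺ m<k cm
    max∈ : foldr _⊔_ 0 candidates ∈ candidates
    max∈ with ⊔-foldr-∈ candidates
    ... | inj₁ ∈cand = ∈cand
    ... | inj₂ max≡0 = subst (_∈ candidates) (trans (n≤0⇒n≡0 (subst (m ≤_) max≡0 (⊔-foldr-upper m∈))) (sym max≡0)) m∈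

  rpos≢0⇒ : rpos s ≢ 0 → rmin s ≢ length s × RposMaximal s (rpos s)
  rpos≢0⇒ r≢0 = k≢n , rpos-candidate k≢n rpos∈
    where
    k≢n : rmin s ≢ length s
    k≢n = r≢0 ∘ rpos-full
    rpos∈ : rpos s ∈ candidates
    rpos∈ with ⊔-foldr-∈ candidates
    ... | inj₁ ∈cand = subst (_∈ candidates) (sym (rpos-unfold k≢n)) ∈cand
    ... | inj₂ max≡0 = ⊥-elim (r≢0 (trans (rpos-unfold k≢n) max≡0))

-- Raising one entry

-- For lo = s ∈ T₅,₂ and hi = f₅₂ s: P = Prm(s)_rpos(s), Q = Prm(s)_rpos(s)+1,
-- and w is the second rightmost occurrence of a = Rmin(s)_rpos(s).
record Raising (lo hi : List ℕ) : Set where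
  field
    w P Q a b : ℕ
    length-≡ : length hi ≡ length lo
    agree    : ∀ i → i ≢ P → at hi i ≡ at lo i
    lo-P     : at lo P ≡ a
    hi-P     : at hi P ≡ b
    lo-w     : at lo w ≡ a
    lo-Q     : at lo Q ≡ b
    a<b      : a < b
    1≤w      : 1 ≤ w
    w+1<P    : suc w < P
    P+1<Q    : suc P < Q
    Q≤n      : Q ≤ length lo
    b≤gap    : ∀ i → w < i → i < P → b ≤ at lo i
    b≤after  : ∀ i → P < i → i ≤ length lo → b ≤ at lo i
    only-Q   : ∀ i → P < i → i ≤ length lo → at lo i ≡ b → i ≡ Q

module Raised {lo hi : List ℕ} (R : Raising lo hi) where
  open Raising R

  w<P : w < P
  w<P = <-trans (n<1+n w) w+1<P

  P<Q : P < Q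
  P<Q = <-trans (n<1+n P) P+1<Q

  P≤n : P ≤ length lo
  P≤n = ≤-trans (<⇒≤ P<Q) Q≤n

  w≤n : w ≤ length lo
  w≤n = ≤-trans (<⇒≤ w<P) P≤n

  1≤P : 1 ≤ P
  1≤P = ≤-trans 1≤w (<⇒≤ w<P)

  ≤n⇒≤hi : ∀ {i} → i ≤ length lo → i ≤ length hi
  ≤n⇒≤hi {i} = subst (i ≤_) (sym length-≡)

  ≤hi⇒≤n : ∀ {i} → i ≤ length hi → i ≤ length lo
  ≤hi⇒≤n {i} = subst (i ≤_) length-≡

  agree-< : ∀ {i} → i < P → at hi i ≡ at lo i
  agree-< i<P = agree _ (<⇒≢ i<P)

  agree-> : ∀ {i} → P < i → at hi i ≡ at lo i
  agree-> P<i = agree _ (≢-sym (<⇒≢ P<i))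

  hi-w : at hi w ≡ a
  hi-w = trans (agree-< w<P) lo-w

  hi-Q : at hi Q ≡ b
  hi-Q = trans (agree-> P<Q) lo-Q

  a≤window : ∀ i → w ≤ i → i < P → a ≤ at lo i
  a≤window i w≤i i<P with m≤n⇒m<n∨m≡n w≤i
  ... | inj₁ w<i  = <⇒≤ (<-≤-trans a<b (b≤gap i w<i i<P))
  ... | inj₂ refl = ≤-reflexive (sym lo-w)

  b≤hi : ∀ i → w < i → i ≤ length lo → b ≤ at hi i
  b≤hi i w<i i≤n with <-cmp i P
  ... | tri< i<P _ _ = subst (b ≤_) (sym (agree-< i<P)) (b≤gap i w<i i<P)
  ... | tri≈ _ refl _ = ≤-reflexive (sym hi-P)
  ... | tri> _ _ P<i = subst (b ≤_) (sym (agree-> P<i)) (b≤after i P<i i≤n)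

  b<after-Q : ∀ i → Q < i → i ≤ length lo → b < at lo i
  b<after-Q i Q<i i≤n = ≤∧≢⇒< (b≤after i (<-trans P<Q Q<i) i≤n) λ b≡ → <-irrefl (sym (only-Q i (<-trans P<Q Q<i) i≤n (sym b≡))) Q<i

  b<between-PQ : ∀ i → P < i → i < Q → b < at lo i
  b<between-PQ i P<i i<Q = ≤∧≢⇒< (b≤after i P<i i≤n) λ b≡ → <-irrefl (only-Q i P<i i≤n (sym b≡)) i<Q
    where i≤n = ≤-trans (<⇒≤ i<Q) Q≤n

  data Region (i : ℕ) : Set where
    before : i < w → Region i
    window : w ≤ i → i ≤ P → Region i
    after  : P < i → Region i

  region : ∀ i → Region i
  region i with <-cmp i w | <-cmp P i
  ... | tri< i<w _ _ | _           = before i<w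
  ... | _            | tri< P<i _ _ = after P<i
  ... | tri≈ _ refl _ | tri≈ _ _ _  = window ≤-refl (<⇒≤ w<P)
  ... | tri≈ _ refl _ | tri> _ _ i<P = window ≤-refl (<⇒≤ i<P)
  ... | tri> _ _ w<i | tri≈ _ refl _ = window (<⇒≤ w<i) ≤-refl
  ... | tri> _ _ w<i | tri> _ _ i<P  = window (<⇒≤ w<i) (<⇒≤ i<P)

  IsRmin-lo-P : IsRmin lo P
  IsRmin-lo-P j P<j j≤n = subst (_< at lo j) (sym lo-P) (<-≤-trans a<b (b≤after j P<j j≤n))

  IsRmin-lo-Q : IsRmin lo Q
  IsRmin-lo-Q j Q<j j≤n = subst (_< at lo j) (sym lo-Q) (b<after-Q j Q<j j≤n)

  ¬IsRmin-lo : ∀ {i} → w ≤ i → i < P → ¬ IsRmin lo i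
  ¬IsRmin-lo {i} w≤i i<P rmin = <⇒≱ (subst (at lo i <_) lo-P (rmin P i<P P≤n)) (a≤window i w≤i i<P)

  IsRmin-hi-w : IsRmin hi w
  IsRmin-hi-w j w<j j≤n = subst (_< at hi j) (sym hi-w) (<-≤-trans a<b (b≤hi j w<j (≤hi⇒≤n j≤n)))

  ¬IsRmin-hi : ∀ {i} → w < i → i ≤ P → ¬ IsRmin hi i
  ¬IsRmin-hi {i} w<i i≤P rmin =
    <⇒≱ (subst (at hi i <_) hi-Q (rmin Q (≤-<-trans i≤P P<Q) (≤n⇒≤hi Q≤n))) (b≤hi i w<i (≤-trans i≤P P≤n))

  IsRmin-before-lo⇒hi : ∀ {i} → i < w → IsRmin lo i → IsRmin hi i
  IsRmin-before-lo⇒hi {i} i<w rmin j i<j j≤n with j ≟ P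
  ... | yes refl = subst₂ _<_ (sym (agree-< (<-trans i<w w<P))) (sym hi-P)
                     (<-trans (subst (at lo i <_) lo-P (rmin P i<j P≤n)) a<b)
  ... | no j≢P   = subst₂ _<_ (sym (agree-< (<-trans i<w w<P))) (sym (agree j j≢P)) (rmin j i<j (≤hi⇒≤n j≤n))

  IsRmin-before-hi⇒lo : ∀ {i} → i < w → IsRmin hi i → IsRmin lo i
  IsRmin-before-hi⇒lo {i} i<w rmin j i<j j≤n with j ≟ P
  ... | yes refl = subst₂ _<_ (agree-< (<-trans i<w w<P)) (trans hi-w (sym lo-P)) (rmin w i<w (≤n⇒≤hi w≤n))
  ... | no j≢P   = subst₂ _<_ (agree-< (<-trans i<w w<P)) (agree j j≢P) (rmin j i<j (≤n⇒≤hi j≤n))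

  IsRmin-after-lo⇒hi : ∀ {i} → P < i → IsRmin lo i → IsRmin hi i
  IsRmin-after-lo⇒hi P<i = IsRmin-suffix {lo} {hi} (sym length-≡) λ j i≤j → sym (agree-> (<-≤-trans P<i i≤j))

  IsRmin-after-hi⇒lo : ∀ {i} → P < i → IsRmin hi i → IsRmin lo i
  IsRmin-after-hi⇒lo P<i = IsRmin-suffix {hi} {lo} length-≡ λ j i≤j → agree-> (<-≤-trans P<i i≤j)

  P∈prm-lo : P ∈ prm lo
  P∈prm-lo = ∈-prm⁺ lo 1≤P P≤n IsRmin-lo-P

  prm-lo⊆hi : ∀ {z} → z ∈ prm lo → z ≢ P → z ∈ prm hi
  prm-lo⊆hi {z} z∈ z≢P with ∈-prm⁻ lo z∈ | region z
  ... | 1≤z , z≤len , rmin | before z<w   = ∈-prm⁺ hi 1≤z (≤n⇒≤hi z≤len) (IsRmin-before-lo⇒hi z<w rmin)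
  ... | 1≤z , z≤len , rmin | after P<z    = ∈-prm⁺ hi 1≤z (≤n⇒≤hi z≤len) (IsRmin-after-lo⇒hi P<z rmin)
  ... | _   , _   , rmin | window w≤z z≤P = ⊥-elim (¬IsRmin-lo w≤z (≤∧≢⇒< z≤P z≢P) rmin)

  prm-hi⊆lo : ∀ {z} → z ∈ prm hi → z ≢ w → z ∈ prm lo × z ≢ P
  prm-hi⊆lo {z} z∈ z≢w with ∈-prm⁻ hi z∈ | region z
  ... | 1≤z , z≤len , rmin | before z<w =
    ∈-prm⁺ lo 1≤z (≤hi⇒≤n z≤len) (IsRmin-before-hi⇒lo z<w rmin) , <⇒≢ (<-trans z<w w<P)
  ... | 1≤z , z≤len , rmin | after P<z  =
    ∈-prm⁺ lo 1≤z (≤hi⇒≤n z≤len) (IsRmin-after-hi⇒lo P<z rmin) , ≢-sym (<⇒≢ P<z)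
  ... | _ , _ , rmin | window w≤z z≤P = ⊥-elim (¬IsRmin-hi (≤∧≢⇒< w≤z (≢-sym z≢w)) z≤P rmin)

  2≤P : 2 ≤ P
  2≤P = ≤-trans (s≤s 1≤w) (<⇒≤ w+1<P)

  w<P∸1 : w < P ∸ 1
  w<P∸1 = ∸-monoˡ-≤ 1 w+1<P

  P∸1<P : P ∸ 1 < P
  P∸1<P = subst (P ∸ 1 <_) (∸1-suc 1≤P) (n<1+n (P ∸ 1))

  ascent-pairs : ∀ i → (at hi i <ᵇ at hi (suc i)) ≡ (at lo i <ᵇ at lo (suc i))
  ascent-pairs i with i ≟ P | suc i ≟ P
  ... | yes refl | _ = begin
    at hi P <ᵇ at hi (suc P)  ≡⟨ cong₂ _<ᵇ_ hi-P (agree-> (n<1+n P)) ⟩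
    b <ᵇ at lo (suc P)        ≡⟨ <ᵇ-true b<c ⟩
    true                      ≡⟨ sym (<ᵇ-true (<-trans a<b b<c)) ⟩
    a <ᵇ at lo (suc P)        ≡⟨ cong (_<ᵇ at lo (suc P)) (sym lo-P) ⟩
    at lo P <ᵇ at lo (suc P)  ∎
    where
    open ≡-Reasoning
    b<c = b<between-PQ (suc P) (n<1+n P) P+1<Q
  ... | no i≢P | yes i+1≡P = begin
    at hi i <ᵇ at hi (suc i)  ≡⟨ cong₂ _<ᵇ_ (agree i i≢P) (trans (cong (at hi) i+1≡P) hi-P) ⟩
    at lo i <ᵇ b              ≡⟨ <ᵇ-false b≤d ⟩
    false                     ≡⟨ sym (<ᵇ-false (≤-trans (<⇒≤ a<b) b≤d)) ⟩
    at lo i <ᵇ a              ≡⟨ cong (at lo i <ᵇ_) (sym (trans (cong (at lo) i+1≡P) lo-P)) ⟩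
    at lo i <ᵇ at lo (suc i)  ∎
    where
    open ≡-Reasoning
    b≤d = b≤gap i (s≤s⁻¹ (subst (suc (suc w) ≤_) (sym i+1≡P) w+1<P)) (subst (i <_) i+1≡P (n<1+n i))
  ... | no i≢P | no i+1≢P = cong₂ _<ᵇ_ (agree i i≢P) (agree (suc i) i+1≢P)

  asc-prefix-≡ : ∀ m → asc (take m hi) ≡ asc (take m lo)
  asc-prefix-≡ = asc-take-cong hi lo length-≡ (λ i _ _ → ascent-pairs i)

  asc-≡ : asc lo ≡ asc hi
  asc-≡ = asc-cong lo hi (sym length-≡) (λ i _ _ → sym (ascent-pairs i))

  IsAscent-lo⇒hi : IsAscent lo → IsAscent hi
  IsAscent-lo⇒hi asc-lo = IsAscent-transfer asc-lo length-≡ asc-prefix-≡ dominated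
    where
    dominated : ∀ i → 1 ≤ i → i ≤ length lo → at hi i ≤ at lo i ⊎ (2 ≤ i × at hi i ≤ at lo (i ∸ 1))
    dominated i _ _ with i ≟ P
    ... | yes refl = inj₂ (2≤P , subst (_≤ at lo (P ∸ 1)) (sym hi-P) (b≤gap (P ∸ 1) w<P∸1 P∸1<P))
    ... | no i≢P   = inj₁ (≤-reflexive (agree i i≢P))

  IsAscent-hi⇒lo : IsAscent hi → IsAscent lo
  IsAscent-hi⇒lo asc-hi = IsAscent-transfer asc-hi (sym length-≡) (sym ∘ asc-prefix-≡) dominated
    where
    dominated : ∀ i → 1 ≤ i → i ≤ length hi → at lo i ≤ at hi i ⊎ (2 ≤ i × at lo i ≤ at hi (i ∸ 1))
    dominated i _ _ with i ≟ P
    ... | yes refl = inj₁ (subst₂ _≤_ (sym lo-P) (sym hi-P) (<⇒≤ a<b))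
    ... | no i≢P   = inj₁ (≤-reflexive (sym (agree i i≢P)))

  rep-≡ : rep lo ≡ rep hi
  rep-≡ = cong₂ _∸_ (sym length-≡) (deduplicate-length-cong lo⊆hi hi⊆lo)
    where
    lo⊆hi : ∀ {z} → z ∈ lo → z ∈ hi
    lo⊆hi z∈ with ∈⇒at z∈
    ... | i , 1≤i , i≤n , refl with i ≟ P
    ...   | yes refl = subst (_∈ hi) (trans hi-w (sym lo-P)) (at-∈ hi 1≤w (≤n⇒≤hi w≤n))
    ...   | no i≢P   = subst (_∈ hi) (agree i i≢P) (at-∈ hi 1≤i (≤n⇒≤hi i≤n))
    hi⊆lo : ∀ {z} → z ∈ hi → z ∈ lo
    hi⊆lo z∈ with ∈⇒at z∈
    ... | i , 1≤i , i≤n , refl with i ≟ P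
    ...   | yes refl = subst (_∈ lo) (trans lo-Q (sym hi-P)) (at-∈ lo (≤-trans 1≤P (<⇒≤ P<Q)) Q≤n)
    ...   | no i≢P   = subst (_∈ lo) (sym (agree i i≢P)) (at-∈ lo 1≤i (≤hi⇒≤n i≤n))

  maxS-≡ : IsInversion lo → maxS lo ≡ maxS hi
  maxS-≡ inv = trans (countPos-cong lo pointwise) (countPos-length {lo} {hi} _ (sym length-≡))
    where
    b<P∸1 : b < P ∸ 1
    b<P∸1 = ≤-<-trans (b≤gap (P ∸ 1) w<P∸1 P∸1<P) (inv (P ∸ 1) (≤-trans 1≤w (<⇒≤ w<P∸1)) (≤-trans (<⇒≤ P∸1<P) P≤n))
    pointwise : ∀ i → 1 ≤ i → i ≤ length lo → (at lo i ≡ᵇ (i ∸ 1)) ≡ (at hi i ≡ᵇ (i ∸ 1))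
    pointwise i _ _ with i ≟ P
    ... | yes refl = begin
      at lo P ≡ᵇ (P ∸ 1)  ≡⟨ cong (_≡ᵇ (P ∸ 1)) lo-P ⟩
      a ≡ᵇ (P ∸ 1)        ≡⟨ ≡ᵇ-false (<⇒≢ (<-trans a<b b<P∸1)) ⟩
      false               ≡⟨ sym (≡ᵇ-false (<⇒≢ b<P∸1)) ⟩
      b ≡ᵇ (P ∸ 1)        ≡⟨ cong (_≡ᵇ (P ∸ 1)) (sym hi-P) ⟩
      at hi P ≡ᵇ (P ∸ 1)  ∎
      where open ≡-Reasoning
    ... | no i≢P = cong (_≡ᵇ (i ∸ 1)) (sym (agree i i≢P))

  zeroS-≡ : zeroS lo ≡ zeroS hi + χ (a ≟ 0)
  zeroS-≡ with a ≟ 0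
  ... | yes a≡0 = begin
    zeroS lo                                       ≡⟨ length-filterᵇ-suc _ _ (AllPairs.map <⇒≢ (positions-sorted lo))
                                                        (∈-positions⁺ lo 1≤P P≤n) lo-P≡0 hi-P≢0 same ⟩
    suc (countPos lo (λ i → at hi i ≡ᵇ 0))         ≡⟨ cong suc (countPos-length {lo} {hi} _ (sym length-≡)) ⟩
    suc (zeroS hi)                                 ≡⟨ +-comm 1 (zeroS hi) ⟩
    zeroS hi + 1                                   ∎
    where
    open ≡-Reasoning
    lo-P≡0 : T (at lo P ≡ᵇ 0)
    lo-P≡0 = ≡⇒≡ᵇ _ _ (trans lo-P a≡0)
    hi-P≢0 : ¬ T (at hi P ≡ᵇ 0)
    hi-P≢0 hi-P≡0 = <⇒≢ (≤-<-trans z≤n a<b) (sym (trans (sym hi-P) (≡ᵇ⇒≡ _ _ hi-P≡0)))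
    same : ∀ {i} → i ∈ positions lo → i ≢ P → (at lo i ≡ᵇ 0) ≡ (at hi i ≡ᵇ 0)
    same {i} _ i≢P = cong (_≡ᵇ 0) (sym (agree i i≢P))
  ... | no a≢0 = begin
    zeroS lo                ≡⟨ countPos-cong lo pointwise ⟩
    countPos lo (λ i → at hi i ≡ᵇ 0) ≡⟨ countPos-length {lo} {hi} _ (sym length-≡) ⟩
    zeroS hi                ≡⟨ sym (+-identityʳ (zeroS hi)) ⟩
    zeroS hi + 0            ∎
    where
    open ≡-Reasoning
    pointwise : ∀ i → 1 ≤ i → i ≤ length lo → (at lo i ≡ᵇ 0) ≡ (at hi i ≡ᵇ 0)
    pointwise i _ _ with i ≟ P
    ... | yes refl = trans (cong (_≡ᵇ 0) lo-P) (trans (≡ᵇ-false a≢0)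
                       (sym (trans (cong (_≡ᵇ 0) hi-P) (≡ᵇ-false (≢-sym (<⇒≢ (≤-<-trans z≤n a<b)))))))
    ... | no i≢P   = cong (_≡ᵇ 0) (sym (agree i i≢P))

  -- If P directly follows the fixed points, then w and w + 1 are fixed points too,
  -- which pins a = w - 1 and b = w.
  P≡M+1⇒b≡a+1 : IsAscent lo → P ≡ suc (maxS lo) → b ≡ suc a
  P≡M+1⇒b≡a+1 asc-lo P≡M+1 = ≤-antisym b≤a+1 a<b
    where
    w<M : w < maxS lo
    w<M = s≤s⁻¹ (subst (suc w <_) P≡M+1 w+1<P)
    a+1≡w : suc a ≡ w
    a+1≡w = trans (cong suc (trans (sym lo-w) (maxS-prefix asc-lo 1≤w (<⇒≤ w<M)))) (∸1-suc 1≤w)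
    b≤a+1 : b ≤ suc a
    b≤a+1 = subst (b ≤_) (trans (maxS-prefix asc-lo (s≤s z≤n) w<M) (sym a+1≡w)) (b≤gap (suc w) (n<1+n w) w+1<P)

  ealm-≡ : IsAscent lo → ealm lo + χ (P ≟ suc (maxS lo)) ≡ ealm hi
  ealm-≡ asc-lo with maxS lo ≟ length lo
  ... | yes M≡n = begin
    ealm lo + χ (P ≟ suc (maxS lo))  ≡⟨ cong₂ _+_ (ealm-full lo M≡n) (χ-no (P ≟ suc (maxS lo)) P≢M+1) ⟩
    0                                ≡⟨ sym (ealm-full hi (trans (sym M≡) (trans M≡n (sym length-≡)))) ⟩
    ealm hi                          ∎
    where
    open ≡-Reasoning
    M≡ = maxS-≡ (proj₁ asc-lo)
    P≢M+1 : P ≢ suc (maxS lo)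
    P≢M+1 P≡ = <⇒≱ (subst (_≤ maxS lo) P≡ (subst (P ≤_) (sym M≡n) P≤n)) ≤-refl
  ... | no M≢n = begin
    ealm lo + χ (P ≟ suc (maxS lo))                ≡⟨ cong (_+ χ (P ≟ suc (maxS lo))) (ealm-partial lo M≢n) ⟩
    at lo (suc (maxS lo)) + χ (P ≟ suc (maxS lo)) ≡⟨ next (P ≟ suc (maxS lo)) ⟩
    at hi (suc (maxS lo))                          ≡⟨ cong (λ m → at hi (suc m)) M≡ ⟩
    at hi (suc (maxS hi))                          ≡⟨ sym (ealm-partial hi (λ e → M≢n (trans M≡ (trans e length-≡)))) ⟩
    ealm hi                                        ∎
    where
    open ≡-Reasoning
    M≡ = maxS-≡ (proj₁ asc-lo)
    next : (d : Dec (P ≡ suc (maxS lo))) → at lo (suc (maxS lo)) + χ d ≡ at hi (suc (maxS lo))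
    next (no P≢M+1)  = trans (+-identityʳ _) (sym (agree _ (≢-sym P≢M+1)))
    next (yes P≡M+1) = begin
      at lo (suc (maxS lo)) + 1  ≡⟨ cong (λ i → at lo i + 1) (sym P≡M+1) ⟩
      at lo P + 1                ≡⟨ cong (_+ 1) lo-P ⟩
      a + 1                      ≡⟨ +-comm a 1 ⟩
      suc a                      ≡⟨ sym (P≡M+1⇒b≡a+1 asc-lo P≡M+1) ⟩
      b                          ≡⟨ sym hi-P ⟩
      at hi P                    ≡⟨ cong (at hi) P≡M+1 ⟩
      at hi (suc (maxS lo))      ∎

  restore-lo : setAt hi (P ∸ 1) a ≡ lo
  restore-lo = subst (λ v → setAt hi (P ∸ 1) v ≡ lo) lo-P (setAt-restore length-≡ 1≤P P≤n agree)

  restore-hi : setAt lo (P ∸ 1) b ≡ hi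
  restore-hi = subst (λ v → setAt lo (P ∸ 1) v ≡ hi) hi-P
    (setAt-restore (sym length-≡) 1≤P (≤n⇒≤hi P≤n) (λ i i≢P → sym (agree i i≢P)))

  lo≢upTo : lo ≢ upTo (length lo)
  lo≢upTo = repeated⇒≢upTo 1≤w w<P P≤n (trans lo-w (sym lo-P))

  rocc-lo-a : rocc1 lo a ≡ P × rocc2 lo a ≡ w
  rocc-lo-a = rocc≡ lo 1≤w w<P P≤n lo-w lo-P
    (λ z P<z z≤len lz≡a → <⇒≱ a<b (subst (b ≤_) lz≡a (b≤after z P<z z≤len)))
    (λ z w<z z<P lz≡a → <⇒≱ a<b (subst (b ≤_) lz≡a (b≤gap z w<z z<P)))

  rocc1-hi-a : rocc1 hi a ≡ w
  rocc1-hi-a = rocc1≡ hi 1≤w (≤n⇒≤hi w≤n) hi-w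
    λ z w<z z≤len hz≡a → <⇒≱ a<b (subst (b ≤_) hz≡a (b≤hi z w<z (≤hi⇒≤n z≤len)))

  rocc-hi-b : rocc1 hi b ≡ Q × rocc2 hi b ≡ P
  rocc-hi-b = rocc≡ hi 1≤P P<Q (≤n⇒≤hi Q≤n) hi-P hi-Q
    (λ z Q<z z≤len hz≡b → <-irrefl (sym (trans (sym (agree-> (<-trans P<Q Q<z))) hz≡b)) (b<after-Q z Q<z (≤hi⇒≤n z≤len)))
    (λ z P<z z<Q hz≡b → <-irrefl (sym (trans (sym (agree-> P<z)) hz≡b)) (b<between-PQ z P<z z<Q))

  rmin-lo≢n : rmin lo ≢ length lo
  rmin-lo≢n k≡n = ¬IsRmin-lo ≤-refl w<P (rmin≡length⇒IsRmin lo k≡n 1≤w w≤n)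

  module AtIndex {r : ℕ} (r<k : r < rmin lo) (Prm-r : Prm lo r ≡ P) where

    prm-hi : prm hi ≡ setAt (prm lo) r w
    prm-hi = sorted-setAt (prm-sorted lo) (prm-sorted hi) r<k (subst (w <_) (sym Prm-r) w<P)
      (λ z∈ w≤z z<P → ¬IsRmin-lo w≤z (subst (_ <_) Prm-r z<P) (proj₂ (proj₂ (∈-prm⁻ lo z∈))))
      (∈-prm⁺ hi 1≤w (≤n⇒≤hi w≤n) IsRmin-hi-w)
      (λ z∈ z≢ → prm-lo⊆hi z∈ (subst (_ ≢_) Prm-r z≢))
      (λ z∈ z≢w → let z∈lo , z≢P = prm-hi⊆lo z∈ z≢w in z∈lo , subst (_ ≢_) (sym Prm-r) z≢P)

    rmin-≡ : rmin hi ≡ rmin lo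
    rmin-≡ = trans (cong length prm-hi) (length-setAt (prm lo) r w)

    Prm-hi-r : Prm hi r ≡ w
    Prm-hi-r = trans (cong (λ ps → nth ps r) prm-hi) (nth-setAt-≡ (prm lo) w r<k)

    Prm-hi-≢ : ∀ {j} → j ≢ r → Prm hi j ≡ Prm lo j
    Prm-hi-≢ {j} j≢r = trans (cong (λ ps → nth ps j) prm-hi) (nth-setAt-≢ (prm lo) w j≢r)

    Rmin-≡ : ∀ j → Rmin hi j ≡ Rmin lo j
    Rmin-≡ j with j ≟ r
    ... | yes refl = begin
      Rmin hi j         ≡⟨ Rmin≡at hi j ⟩
      at hi (Prm hi j)  ≡⟨ cong (at hi) Prm-hi-r ⟩
      at hi w           ≡⟨ hi-w ⟩
      a                 ≡⟨ sym lo-P ⟩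
      at lo P           ≡⟨ cong (at lo) (sym Prm-r) ⟩
      at lo (Prm lo j)  ≡⟨ sym (Rmin≡at lo j) ⟩
      Rmin lo j         ∎
      where open ≡-Reasoning
    ... | no j≢r = begin
      Rmin hi j         ≡⟨ Rmin≡at hi j ⟩
      at hi (Prm hi j)  ≡⟨ cong (at hi) (Prm-hi-≢ j≢r) ⟩
      at hi (Prm lo j)  ≡⟨ agree _ Prm-j≢P ⟩
      at lo (Prm lo j)  ≡⟨ sym (Rmin≡at lo j) ⟩
      Rmin lo j         ∎
      where
      open ≡-Reasoning
      Prm-j≢P : Prm lo j ≢ P
      Prm-j≢P Prm-j≡P with j <? rmin lo
      ... | yes j<k = j≢r (Prm-injective lo j<k r<k (trans Prm-j≡P (sym Prm-r)))
      ... | no j≮k  = <⇒≢ 1≤P (trans (sym (nth-≥length (prm lo) (≮⇒≥ j≮k))) Prm-j≡P)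

    Rmin-r : Rmin lo r ≡ a
    Rmin-r = trans (Rmin≡at lo r) (trans (cong (at lo) Prm-r) lo-P)

    next-is-Q : suc r < rmin lo × Prm lo (suc r) ≡ Q
    next-is-Q =
      let r+1<k , Prm-r+1≤Q = Prm-next lo r<k (∈-prm⁺ lo (≤-trans 1≤P (<⇒≤ P<Q)) Q≤n IsRmin-lo-Q) (subst (_< Q) (sym Prm-r) P<Q)
          P<Prm-r+1 = subst (_< Prm lo (suc r)) Prm-r (Prm-mono lo (n<1+n r) r+1<k)
          _ , _ , rmin = Prm-spec lo r+1<k
      in r+1<k , ≤-antisym Prm-r+1≤Q (≮⇒≥ λ Prm<Q →
           <⇒≱ (subst (_ <_) lo-Q (rmin Q Prm<Q Q≤n)) (<⇒≤ (b<between-PQ _ P<Prm-r+1 Prm<Q)))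

    r+1<k : suc r < rmin lo
    r+1<k = proj₁ next-is-Q

    Prm-r+1 : Prm lo (suc r) ≡ Q
    Prm-r+1 = proj₂ next-is-Q

    Rmin-r+1 : Rmin lo (suc r) ≡ b
    Rmin-r+1 = trans (Rmin≡at lo (suc r)) (trans (cong (at lo) Prm-r+1) lo-Q)

    rposCond-lo-r : T (rposCond lo r)
    rposCond-lo-r = cond r refl
      where
      cond : ∀ m → m ≡ r → T (rposCond lo m)
      cond zero    refl = ≤⇒≤ᵇ (∈⇒length≥2 (∈-occ⁺ lo 1≤w w≤n (trans lo-w (sym Rmin-r)))
                                           (∈-occ⁺ lo 1≤P P≤n (trans lo-P (sym Rmin-r))) (<⇒≢ w<P))
      cond (suc m) refl = rposCond-suc⁺ lo m Prm-m<w w<P P≤n (trans lo-w (sym Rmin-r)) (trans lo-P (sym Rmin-r))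
        where
        Prm-m<P = subst (Prm lo m <_) Prm-r (Prm-mono lo (n<1+n m) r<k)
        Prm-m<w : Prm lo m < w
        Prm-m<w = ≰⇒> λ w≤Prm → ¬IsRmin-lo w≤Prm Prm-m<P (proj₂ (proj₂ (Prm-spec lo (<-trans (n<1+n m) r<k))))

    rposCond-hi-r+1 : T (rposCond hi (suc r))
    rposCond-hi-r+1 = rposCond-suc⁺ hi r (subst (_< P) (sym Prm-hi-r) w<P) P<Q (≤n⇒≤hi Q≤n)
      (trans hi-P (sym b≡)) (trans hi-Q (sym b≡))
      where b≡ = trans (Rmin-≡ (suc r)) Rmin-r+1

    ¬rposCond-lo-r+1 : ¬ T (rposCond lo (suc r))
    ¬rposCond-lo-r+1 = rposCond-suc-unique lo r Q λ z Prm<z z≤len lz →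
      only-Q z (subst (_< z) Prm-r Prm<z) z≤len (trans lz Rmin-r+1)

    rposCond-≡ : ∀ {m} → r < m → suc m < rmin lo → rposCond lo (suc m) ≡ rposCond hi (suc m)
    rposCond-≡ {m} r<m m+1<k = rposCond-suc-cong {lo} {hi} m (sym length-≡) (sym (Prm-hi-≢ (≢-sym (<⇒≢ r<m)))) (sym (Rmin-≡ (suc m)))
      λ i Prm<i _ → sym (agree-> (<-trans (subst (_< Prm lo m) Prm-r (Prm-mono lo r<m (<-trans (n<1+n m) m+1<k))) Prm<i))

    rpos-lo⇒hi : rpos lo ≡ r → rpos hi ≡ suc r
    rpos-lo⇒hi rpos≡r = rpos≡ hi (λ e → rmin-lo≢n (trans (sym rmin-≡) (trans e length-≡)))
      (subst (suc r <_) (sym rmin-≡) r+1<k , rposCond-hi-r+1 , maximal)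
      where
      lo-maximal = subst (λ x → RposMaximal lo x) rpos≡r (rpos-maximal lo rmin-lo≢n r<k rposCond-lo-r)
      maximal : ∀ m → suc r < m → m < rmin hi → ¬ T (rposCond hi m)
      maximal (suc m) r+1<m+1 m+1<k cond =
        proj₂ (proj₂ lo-maximal) (suc m) (<-trans (n<1+n r) r+1<m+1) (subst (suc m <_) rmin-≡ m+1<k)
          (subst T (sym (rposCond-≡ (s≤s⁻¹ r+1<m+1) (subst (suc m <_) rmin-≡ m+1<k))) cond)

    rpos-hi⇒lo : rpos hi ≡ suc r → rpos lo ≡ r
    rpos-hi⇒lo rpos≡r+1 = rpos≡ lo rmin-lo≢n (r<k , rposCond-lo-r , maximal)
      where
      hi-maximal = subst (λ x → RposMaximal hi x) rpos≡r+1
        (rpos-maximal hi (λ e → rmin-lo≢n (trans (sym rmin-≡) (trans e length-≡)))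
          (subst (suc r <_) (sym rmin-≡) r+1<k) rposCond-hi-r+1)
      maximal : ∀ m → r < m → m < rmin lo → ¬ T (rposCond lo m)
      maximal (suc m) r<m+1 m+1<k cond with m ≟ r
      ... | yes refl = ¬rposCond-lo-r+1 cond
      ... | no m≢r   = proj₂ (proj₂ hi-maximal) (suc m) (s≤s r<m) (subst (suc m <_) (sym rmin-≡) m+1<k)
                         (subst T (rposCond-≡ r<m m+1<k) cond)
        where r<m = ≤∧≢⇒< (s≤s⁻¹ r<m+1) (≢-sym m≢r)

    b≤sebr-lo : rpos lo ≡ r → b ≤ sebr lo
    b≤sebr-lo rpos≡r = ≤sebr lo
      (subst (λ v → 2 ≤ length (occ lo v)) (sym v≡a) (∈⇒length≥2 (∈-occ⁺ lo 1≤w w≤n lo-w) (∈-occ⁺ lo 1≤P P≤n lo-P) (<⇒≢ w<P)))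
      (subst (λ v → suc (rocc2 lo v) < rocc1 lo v) (sym v≡a) (subst₂ (λ x y → suc y < x) (sym r₁≡P) (sym r₂≡w) w+1<P))
      λ i r₂<i i<r₁ _ → b≤gap i (subst (_< i) (trans (cong (rocc2 lo) v≡a) r₂≡w) r₂<i)
                                 (subst (i <_) (trans (cong (rocc1 lo) v≡a) r₁≡P) i<r₁)
      where
      v≡a : Rmin lo (rpos lo) ≡ a
      v≡a = trans (cong (Rmin lo) rpos≡r) Rmin-r
      r₁≡P = proj₁ rocc-lo-a
      r₂≡w = proj₂ rocc-lo-a

-- The bijection

-- Positions are 1-based, setAt indices 0-based.
f₅₂ : List ℕ → List ℕ
f₅₂ s = setAt s (Prm s (rpos s) ∸ 1) (Rmin s (suc (rpos s)))

f₅₂⁻¹ : List ℕ → List ℕ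
f₅₂⁻¹ t = setAt t (rocc2 t (Rmin t (rpos t)) ∸ 1) (Rmin t (rpos t ∸ 1))

module Forward {s : List ℕ} (asc-s : IsAscent s) (s∈T : InT52 s) where

  private
    r = rpos s
    P = Prm s r
    Q = Prm s (suc r)
    a = Rmin s r
    b = Rmin s (suc r)

    r+1<k : suc r < rmin s
    r+1<k = proj₁ (proj₂ (proj₁ s∈T))

    r<k : r < rmin s
    r<k = <-trans (n<1+n r) r+1<k

    a<b : a < b
    a<b = Rmin-mono s (n<1+n r) r+1<k

    P<Q : P < Q
    P<Q = Prm-mono s (n<1+n r) r+1<k

    P-spec = Prm-spec s r<k
    Q-spec = Prm-spec s r+1<k

    1≤P = proj₁ P-spec
    P≤n = proj₁ (proj₂ P-spec)
    Q≤n = proj₁ (proj₂ Q-spec)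

    a<after-P : ∀ i → P < i → i ≤ length s → a < at s i
    a<after-P i P<i i≤n = subst (_< at s i) (sym (Rmin≡at s r)) (proj₂ (proj₂ P-spec) i P<i i≤n)

    b≤after : ∀ i → P < i → i ≤ length s → b ≤ at s i
    b≤after i = Rmin-suc-≤ s r+1<k

    gap-spec = ≤sebr⇒ s (≤-trans (s≤s z≤n) a<b) (proj₂ (proj₂ (proj₁ s∈T)))

    rocc1-a : rocc1 s a ≡ P
    rocc1-a = rocc1≡ s 1≤P P≤n (sym (Rmin≡at s r)) λ z P<z z≤len sz≡a → <-irrefl (sym sz≡a) (a<after-P z P<z z≤len)

    w = rocc2 s a
    w-spec = rocc2-spec s a (proj₁ gap-spec)

    w+1<P : suc w < P
    w+1<P = subst (suc w <_) rocc1-a (proj₁ (proj₂ gap-spec))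

    b≤gap : ∀ i → w < i → i < P → b ≤ at s i
    b≤gap i w<i i<P = proj₂ (proj₂ gap-spec) i w<i (subst (i <_) (sym rocc1-a) i<P) (<⇒≤ (<-≤-trans i<P P≤n))

    k≢n : rmin s ≢ length s
    k≢n k≡n = <-irrefl (trans (proj₁ (proj₂ (proj₂ w-spec))) (Rmin≡at s r))
      (rmin≡length⇒IsRmin s k≡n (proj₁ w-spec) (<⇒≤ (<-≤-trans (<-trans (n<1+n w) w+1<P) P≤n)) P (<-trans (n<1+n w) w+1<P) P≤n)

    r-maximal : RposMaximal s r
    r-maximal with rpos s ≟ 0
    ... | no r≢0  = proj₂ (rpos≢0⇒ s r≢0)
    ... | yes r≡0 = rpos-maximal s k≢n (subst (_< rmin s) r≡0 r<k)
                      (≤⇒≤ᵇ (subst (λ m → 2 ≤ length (occ s (Rmin s m))) r≡0 (proj₁ gap-spec)))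

    P+1<Q : suc P < Q
    P+1<Q = ≤∧≢⇒< P<Q (≢-sym (proj₂ s∈T))

    only-Q : ∀ i → P < i → i ≤ length s → at s i ≡ b → i ≡ Q
    only-Q i P<i i≤n si≡b with <-cmp i Q
    ... | tri≈ _ i≡Q _ = i≡Q
    ... | tri< i<Q _ _ = ⊥-elim (proj₂ (proj₂ r-maximal) (suc r) (n<1+n r) r+1<k
                           (rposCond-suc⁺ s r P<i i<Q Q≤n si≡b (sym (Rmin≡at s (suc r)))))
    ... | tri> _ _ Q<i = ⊥-elim (proj₂ (proj₂ r-maximal) (suc r) (n<1+n r) r+1<k
                           (rposCond-suc⁺ s r P<Q Q<i i≤n (sym (Rmin≡at s (suc r))) si≡b))

  raising : Raising s (f₅₂ s)
  raising = record
    { w = w ; P = P ; Q = Q ; a = a ; b = b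
    ; length-≡ = length-setAt s (P ∸ 1) b
    ; agree    = λ i i≢P → at-setAt-≢ s b 1≤P i≢P
    ; lo-P     = sym (Rmin≡at s r)
    ; hi-P     = at-setAt-≡ s b 1≤P P≤n
    ; lo-w     = proj₁ (proj₂ (proj₂ w-spec))
    ; lo-Q     = sym (Rmin≡at s (suc r))
    ; a<b      = a<b
    ; 1≤w      = proj₁ w-spec
    ; w+1<P    = w+1<P
    ; P+1<Q    = P+1<Q
    ; Q≤n      = Q≤n
    ; b≤gap    = b≤gap
    ; b≤after  = b≤after
    ; only-Q   = only-Q
    }

  open Raised raising public
    using (asc-≡; rep-≡; maxS-≡; zeroS-≡; ealm-≡; IsAscent-lo⇒hi; rocc1-hi-a; rocc-hi-b; restore-lo)
  open Raised.AtIndex raising r<k refl public using (rmin-≡; Rmin-≡; rpos-lo⇒hi)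

  rpos-f₅₂ : rpos (f₅₂ s) ≡ suc r
  rpos-f₅₂ = rpos-lo⇒hi refl

  private
    Rmin-f₅₂ : Rmin (f₅₂ s) (rpos (f₅₂ s)) ≡ b
    Rmin-f₅₂ = trans (cong (Rmin (f₅₂ s)) rpos-f₅₂) (Rmin-≡ (suc r))

    Rmin-f₅₂-1 : Rmin (f₅₂ s) (rpos (f₅₂ s) ∸ 1) ≡ a
    Rmin-f₅₂-1 = trans (cong (λ m → Rmin (f₅₂ s) (m ∸ 1)) rpos-f₅₂) (Rmin-≡ r)

    rocc1-f₅₂-a : rocc1 (f₅₂ s) (Rmin (f₅₂ s) (rpos (f₅₂ s) ∸ 1)) ≡ w
    rocc1-f₅₂-a = trans (cong (rocc1 (f₅₂ s)) Rmin-f₅₂-1) rocc1-hi-a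

    rocc1-f₅₂-b : rocc1 (f₅₂ s) (Rmin (f₅₂ s) (rpos (f₅₂ s))) ≡ Q
    rocc1-f₅₂-b = trans (cong (rocc1 (f₅₂ s)) Rmin-f₅₂) (proj₁ rocc-hi-b)

    rocc2-f₅₂-b : rocc2 (f₅₂ s) (Rmin (f₅₂ s) (rpos (f₅₂ s))) ≡ P
    rocc2-f₅₂-b = trans (cong (rocc2 (f₅₂ s)) Rmin-f₅₂) (proj₂ rocc-hi-b)

  f₅₂-target : ∀ {n} → length s ≡ n → InTarget n (f₅₂ s)
  f₅₂-target len = (IsAscent-lo⇒hi asc-s , trans (length-setAt s _ _) len)
    , (λ e → 0≢1+n (trans (sym e) rpos-f₅₂))
    , (λ e → <⇒≢ w+1<P (trans (cong suc (sym rocc1-f₅₂-a)) (trans e rocc2-f₅₂-b)))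
    , (λ e → <⇒≢ P+1<Q (trans (cong suc (sym rocc2-f₅₂-b)) (trans e rocc1-f₅₂-b)))

  f₅₂⁻¹-f₅₂ : f₅₂⁻¹ (f₅₂ s) ≡ s
  f₅₂⁻¹-f₅₂ = trans (cong₂ (λ p v → setAt (f₅₂ s) (p ∸ 1) v) rocc2-f₅₂-b Rmin-f₅₂-1) restore-lo

  zeroS-f₅₂ : zeroS s ≡ zeroS (f₅₂ s) + χ (rpos s ≟ 0)
  zeroS-f₅₂ = trans zeroS-≡ (cong (zeroS (f₅₂ s) +_) (χ-cong (a ≟ 0) (rpos s ≟ 0) a≡0⇒r≡0 r≡0⇒a≡0))
    where
    Rmin-0≡0 = Rmin-0 s (proj₁ asc-s) (≤-trans 1≤P P≤n)
    a≡0⇒r≡0 : a ≡ 0 → r ≡ 0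
    a≡0⇒r≡0 a≡0 with r ≟ 0
    ... | yes r≡0 = r≡0
    ... | no r≢0  = ⊥-elim (<⇒≢ (subst (_< a) Rmin-0≡0 (Rmin-mono s (n≢0⇒n>0 r≢0) r<k)) (sym a≡0))
    r≡0⇒a≡0 : r ≡ 0 → a ≡ 0
    r≡0⇒a≡0 r≡0 = trans (cong (Rmin s) r≡0) Rmin-0≡0

module Backward {t : List ℕ} (asc-t : IsAscent t) (rpos≢0 : rpos t ≢ 0)
  (a-not-before-b : suc (rocc1 t (Rmin t (rpos t ∸ 1))) ≢ rocc2 t (Rmin t (rpos t)))
  (b-not-adjacent : suc (rocc2 t (Rmin t (rpos t))) ≢ rocc1 t (Rmin t (rpos t))) where

  private
    r = rpos t ∸ 1
    r+1≡R : suc r ≡ rpos t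
    r+1≡R = ∸1-suc (n≢0⇒n>0 rpos≢0)

    A = Prm t r
    Q = Prm t (suc r)
    a = Rmin t r
    b = Rmin t (suc r)
    v = Rmin t (rpos t)

    v≡b : v ≡ b
    v≡b = cong (Rmin t) (sym r+1≡R)

    R-maximal = subst (RposMaximal t) (sym r+1≡R) (proj₂ (rpos≢0⇒ t rpos≢0))

    r+1<k : suc r < rmin t
    r+1<k = proj₁ R-maximal

    r<k : r < rmin t
    r<k = <-trans (n<1+n r) r+1<k

    a<b : a < b
    a<b = Rmin-mono t (n<1+n r) r+1<k

    A-spec = Prm-spec t r<k
    Q-spec = Prm-spec t r+1<k

    1≤A = proj₁ A-spec
    A≤n = proj₁ (proj₂ A-spec)
    Q≤n = proj₁ (proj₂ Q-spec)

    A<Q : A < Q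
    A<Q = Prm-mono t (n<1+n r) r+1<k

    tA≡a : at t A ≡ a
    tA≡a = sym (Rmin≡at t r)

    tQ≡v : at t Q ≡ v
    tQ≡v = trans (sym (Rmin≡at t (suc r))) (sym v≡b)

    b≤after-A : ∀ i → A < i → i ≤ length t → b ≤ at t i
    b≤after-A i = Rmin-suc-≤ t r+1<k

    v<after-Q : ∀ i → Q < i → i ≤ length t → v < at t i
    v<after-Q i Q<i i≤n = subst (_< at t i) tQ≡v (proj₂ (proj₂ Q-spec) i Q<i i≤n)

    two-v-after-A : ∃[ x ] ∃[ y ] A < x × x < y × y ≤ length t × at t x ≡ v × at t y ≡ v
    two-v-after-A =
      let x , y , A<x , x<y , y≤n , tx≡b , ty≡b = rposCond-suc⁻ t r (proj₁ (proj₂ R-maximal))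
      in x , y , A<x , x<y , y≤n , trans tx≡b (sym v≡b) , trans ty≡b (sym v≡b)

    rocc1-v : rocc1 t v ≡ Q
    rocc1-v = rocc1≡ t (≤-trans 1≤A (<⇒≤ A<Q)) Q≤n tQ≡v λ z Q<z z≤len tz≡v → <-irrefl (sym tz≡v) (v<after-Q z Q<z z≤len)

    two-v : 2 ≤ length (occ t v)
    two-v = let x , y , A<x , x<y , y≤n , tx≡v , ty≡v = two-v-after-A ; 1≤x = ≤-trans (s≤s z≤n) A<x in
      ∈⇒length≥2 (∈-occ⁺ t 1≤x (<⇒≤ (<-≤-trans x<y y≤n)) tx≡v) (∈-occ⁺ t (≤-trans 1≤x (<⇒≤ x<y)) y≤n ty≡v) (<⇒≢ x<y)

    P = rocc2 t v
    P-spec = rocc2-spec t v two-v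
    1≤P = proj₁ P-spec
    tP≡v = proj₁ (proj₂ (proj₂ P-spec))

    P<Q : P < Q
    P<Q = subst (P <_) rocc1-v (proj₁ (proj₂ P-spec))

    P-max : ∀ z → 1 ≤ z → z ≤ length t → at t z ≡ v → z < Q → z ≤ P
    P-max z 1≤z z≤len tz≡v z<Q = proj₂ (proj₂ (proj₂ P-spec)) z 1≤z z≤len tz≡v (subst (z <_) (sym rocc1-v) z<Q)

    A<P : A < P
    A<P = let x , y , A<x , x<y , y≤n , tx≡v , ty≡v = two-v-after-A
              y≤Q = ≮⇒≥ λ Q<y → <-irrefl (sym ty≡v) (v<after-Q y Q<y y≤n)
          in <-≤-trans A<x (P-max x (≤-trans (s≤s z≤n) A<x) (<⇒≤ (<-≤-trans x<y y≤n)) tx≡v (<-≤-trans x<y y≤Q))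

    rocc1-a : rocc1 t a ≡ A
    rocc1-a = rocc1≡ t 1≤A A≤n tA≡a λ z A<z z≤len tz≡a →
      <-irrefl (sym tz≡a) (subst (_< at t z) tA≡a (proj₂ (proj₂ A-spec) z A<z z≤len))

    A+1<P : suc A < P
    A+1<P = ≤∧≢⇒< A<P λ A+1≡P → a-not-before-b (trans (cong suc rocc1-a) A+1≡P)

    P+1<Q : suc P < Q
    P+1<Q = ≤∧≢⇒< P<Q λ P+1≡Q → b-not-adjacent (trans P+1≡Q (sym rocc1-v))

    lo = f₅₂⁻¹ t

    lo-≢P : ∀ i → i ≢ P → at lo i ≡ at t i
    lo-≢P i i≢P = at-setAt-≢ t a 1≤P i≢P

    len-lo : length lo ≡ length t
    len-lo = length-setAt t (P ∸ 1) a

    ≤lo⇒≤n : ∀ {i} → i ≤ length lo → i ≤ length t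
    ≤lo⇒≤n {i} = subst (i ≤_) len-lo

    only-Q : ∀ i → P < i → i ≤ length lo → at lo i ≡ b → i ≡ Q
    only-Q i P<i i≤len lo-i≡b with <-cmp i Q
    ... | tri≈ _ i≡Q _ = i≡Q
    ... | tri< i<Q _ _ = ⊥-elim (<⇒≱ P<i (P-max i (≤-trans 1≤P (<⇒≤ P<i)) (≤lo⇒≤n i≤len) ti≡v i<Q))
      where ti≡v = trans (sym (lo-≢P i (≢-sym (<⇒≢ P<i)))) (trans lo-i≡b (sym v≡b))
    ... | tri> _ _ Q<i = ⊥-elim (<-irrefl (sym ti≡v) (v<after-Q i Q<i (≤lo⇒≤n i≤len)))
      where ti≡v = trans (sym (lo-≢P i (≢-sym (<⇒≢ P<i)))) (trans lo-i≡b (sym v≡b))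

  raising : Raising lo t
  raising = record
    { w = A ; P = P ; Q = Q ; a = a ; b = b
    ; length-≡ = sym len-lo
    ; agree    = λ i i≢P → sym (lo-≢P i i≢P)
    ; lo-P     = at-setAt-≡ t a 1≤P (≤-trans (<⇒≤ P<Q) Q≤n)
    ; hi-P     = trans tP≡v v≡b
    ; lo-w     = trans (lo-≢P A (<⇒≢ A<P)) tA≡a
    ; lo-Q     = trans (lo-≢P Q (≢-sym (<⇒≢ P<Q))) (trans tQ≡v v≡b)
    ; a<b      = a<b
    ; 1≤w      = 1≤A
    ; w+1<P    = A+1<P
    ; P+1<Q    = P+1<Q
    ; Q≤n      = subst (Q ≤_) (sym len-lo) Q≤n
    ; b≤gap    = λ i A<i i<P → subst (b ≤_) (sym (lo-≢P i (<⇒≢ i<P))) (b≤after-A i A<i (≤-trans (<⇒≤ (<-trans i<P P<Q)) Q≤n))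
    ; b≤after  = λ i P<i i≤len → subst (b ≤_) (sym (lo-≢P i (≢-sym (<⇒≢ P<i)))) (b≤after-A i (<-trans A<P P<i) (≤lo⇒≤n i≤len))
    ; only-Q   = only-Q
    }

  open Raised raising using (P∈prm-lo; IsAscent-hi⇒lo; lo≢upTo; restore-hi)

  private
    P-index = ∈⇒nth P∈prm-lo
    j = proj₁ P-index
    j<k = proj₁ (proj₂ P-index)

  open Raised.AtIndex raising j<k (proj₂ (proj₂ P-index))
    using (rmin-≡; Prm-hi-r; rpos-hi⇒lo; Rmin-r+1; Prm-r+1; b≤sebr-lo) renaming (r+1<k to j+1<k)

  rpos-f₅₂⁻¹ : rpos lo ≡ j
  rpos-f₅₂⁻¹ = rpos-hi⇒lo (trans (sym r+1≡R) (cong suc (sym j≡r)))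
    where
    j≡r : j ≡ r
    j≡r = Prm-injective t (subst (j <_) (sym rmin-≡) j<k) r<k Prm-hi-r

  private
    Prm-rpos : Prm lo (rpos lo) ≡ P
    Prm-rpos = trans (cong (Prm lo) rpos-f₅₂⁻¹) (proj₂ (proj₂ P-index))

    Prm-rpos+1 : Prm lo (suc (rpos lo)) ≡ Q
    Prm-rpos+1 = trans (cong (λ m → Prm lo (suc m)) rpos-f₅₂⁻¹) Prm-r+1

    Rmin-rpos+1 : Rmin lo (suc (rpos lo)) ≡ b
    Rmin-rpos+1 = trans (cong (λ m → Rmin lo (suc m)) rpos-f₅₂⁻¹) Rmin-r+1

  f₅₂⁻¹-source : ∀ {n} → length t ≡ n → InA n lo × InT52 lo
  f₅₂⁻¹-source len = (asc-lo , trans len-lo len)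
    , ((asc-lo , lo≢upTo) , subst (λ m → suc m < rmin lo) (sym rpos-f₅₂⁻¹) j+1<k
                          , subst (_≤ sebr lo) (sym Rmin-rpos+1) (b≤sebr-lo rpos-f₅₂⁻¹))
    , λ e → <⇒≢ P+1<Q (trans (cong suc (sym Prm-rpos)) (trans (sym e) Prm-rpos+1))
    where asc-lo = IsAscent-hi⇒lo asc-t

  f₅₂-f₅₂⁻¹ : f₅₂ lo ≡ t
  f₅₂-f₅₂⁻¹ = trans (cong₂ (λ p u → setAt lo (p ∸ 1) u) Prm-rpos Rmin-rpos+1) restore-hi

lemma20 : (n : ℕ) → Σ (List ℕ → List ℕ) λ f →
      (∀ s → InA n s × InT52 s → InTarget n (f s))
    × (∀ s t → InA n s × InT52 s → InA n t × InT52 t → f s ≡ f t → s ≡ t)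
    × (∀ t → InTarget n t → ∃ λ s → (InA n s × InT52 s) × f s ≡ t)
    × (∀ s → InA n s × InT52 s →
          asc s ≡ asc (f s) × rep s ≡ rep (f s) × maxS s ≡ maxS (f s) × rmin s ≡ rmin (f s)
        × suc (rpos s) ≡ rpos (f s)
        × zeroS s ≡ zeroS (f s) + χ (rpos s ≟ 0)
        × ealm s + χ (Prm s (rpos s) ≟ suc (maxS s)) ≡ ealm (f s))
lemma20 n = f₅₂ , into , injective , onto , statistics
  where
  into : ∀ s → InA n s × InT52 s → InTarget n (f₅₂ s)
  into s ((asc-s , len) , s∈T) = Forward.f₅₂-target asc-s s∈T len

  injective : ∀ s t → InA n s × InT52 s → InA n t × InT52 t → f₅₂ s ≡ f₅₂ t → s ≡ t
  injective s t ((asc-s , _) , s∈T) ((asc-t , _) , t∈T) fs≡ft = begin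
    s               ≡⟨ sym (Forward.f₅₂⁻¹-f₅₂ asc-s s∈T) ⟩
    f₅₂⁻¹ (f₅₂ s)   ≡⟨ cong f₅₂⁻¹ fs≡ft ⟩
    f₅₂⁻¹ (f₅₂ t)   ≡⟨ Forward.f₅₂⁻¹-f₅₂ asc-t t∈T ⟩
    t               ∎
    where open ≡-Reasoning

  onto : ∀ t → InTarget n t → ∃ λ s → (InA n s × InT52 s) × f₅₂ s ≡ t
  onto t ((asc-t , len) , rpos≢0 , a-b , b-b) = f₅₂⁻¹ t , Backward.f₅₂⁻¹-source asc-t rpos≢0 a-b b-b len , Backward.f₅₂-f₅₂⁻¹ asc-t rpos≢0 a-b b-b

  statistics : ∀ s → InA n s × InT52 s →
      asc s ≡ asc (f₅₂ s) × rep s ≡ rep (f₅₂ s) × maxS s ≡ maxS (f₅₂ s) × rmin s ≡ rmin (f₅₂ s)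
    × suc (rpos s) ≡ rpos (f₅₂ s)
    × zeroS s ≡ zeroS (f₅₂ s) + χ (rpos s ≟ 0)
    × ealm s + χ (Prm s (rpos s) ≟ suc (maxS s)) ≡ ealm (f₅₂ s)
  statistics s ((asc-s , _) , s∈T) =
    asc-≡ , rep-≡ , maxS-≡ (proj₁ asc-s) , sym rmin-≡ , sym rpos-f₅₂ , zeroS-f₅₂ , ealm-≡ asc-s
    where open Forward asc-s s∈T
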